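{- Let $f(x_1,\dots,x_n)\in R[x_1,\dots,x_n]$ be homogeneous of degree $d$, with $p$-adic generating function $G(z)$ and head $H(z)$. Then $G(z)=H(z)+\frac{1}{q^n}G(z^{\pi^d})$, and the Igusa local zeta function of $f$ is $\mathrm{Ig}(G(z))=\mathrm{Ig}(H(z))/(1-t^d/q^n)$.
   Context: $K$ is a $p$-adic field with valuation ring $R$, uniformizer $\pi$, residue field of order $q$, valuation $v_\pi$ ($v_\pi(0)=\infty$). For $k\in\mathbb N$ let $R_k=R/\pi^kR$, and let $\mathcal A_k$ be the group algebra over $\mathbb C$ of the additive group $R_k$, written multiplicatively with basis $\gamma^A$ ($A\in R_k$), $\gamma^A\gamma^B=\gamma^{A+B}$. Reduction $R_k\to R_j$ ($j\le k$) induces algebra epimorphisms $\mathcal A_k\to\mathcal A_j$; $\mathcal G$ is the inverse limit with projections $\phi_k:\mathcal G\to\mathcal A_k$. For $F\in\mathcal G$ write $\phi_k(F)=\sum_{A\in R_k}F_A\gamma^A$, and $F(1)=\sum_AF_A$ (independent of $k$). The $p$-adic generating function of $f\in R[x_1,\dots,x_n]$ is the element $G\in\mathcal G$ with $\phi_k(G)=q^{ -nk}\sum_{A\in R_k^n}\gamma^{f(A)}$ for all $k$. The head of $G$ is the element $H\in\mathcal G$ with $\phi_k(H)=q^{ -nk}\sum_{A\in R_k^n,\ A\not\equiv(0,\dots,0)\ (\mathrm{mod}\ \pi)}\gamma^{f(A)}$ for all $k\ge1$. For $s\in R$ and $F\in\mathcal G$, $F(z^s)\in\mathcal G$ is defined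 by $\phi_k(F(z^s))=F(1)\gamma^{\pi^kR}$ if $k\le v_\pi(s)$ and $\phi_k(F(z^s))=\sum_{A\in R_{k-v_\pi(s)}}F_A\gamma^{sA}$ if $k\ge v_\pi(s)$ (here $sA$ is the coset of $\pi^kR$ obtained by multiplying $A$ by $s$). $\mathrm{Ig}:\mathcal G\to\mathbb C[[t]]$ is the linear map $\mathrm{Ig}(F)=\sum_{k\ge0}(F_{\pi^kR}-F_{\pi^{k+1}R})t^k$, where $F_{\pi^kR}$ is the coefficient of $\gamma^{\pi^kR}$ in $\phi_k(F)$; $\mathrm{Ig}$ of the generating function of $f$ equals the Igusa local zeta function $\sum_k\mathrm{Vol}\{x\in R^n:v_\pi(f(x))=k\}t^k$. -}

module Defs where

open import Level using (Level; _⊔_)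
open import Algebra.Bundles using (CommutativeRing)
open import Data.Nat as ℕ using (ℕ; zero; suc; _∸_; _≤?_; _≟_)
open import Data.Nat.Properties using (m^n≢0)
open import Data.Integer using (+_)
open import Data.Rational as ℚ using (ℚ; 0ℚ; 1ℚ)
open import Data.Fin using (Fin)
open import Data.Vec as Vec using (Vec; []; _∷_; lookup; toList)
import Data.Vec.Relation.Unary.All as VAll
open import Data.List as List using (List; []; _∷_; map; concatMap; filter; length; foldr; upTo)
open import Data.List.Relation.Unary.All as LAll using ()
open import Data.Product using (Σ; ∃; _×_; _,_)
open import Data.Sum using (_⊎_)
open import Relation.Nullary using (¬_; Dec; yes; no)
open import Relation.Nullary.Decidable using (¬?; _×-dec_)
open import Relation.Binary.PropositionalEquality using (_≡_)

sumℚ : List ℚ → ℚ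
sumℚ = foldr ℚ._+_ 0ℚ

-- q^(-m) as a rational (junk value 0 when q = 0, which never happens
-- for the ring of integers of a p-adic field, whose residue field is nonempty)
invPow : (q m : ℕ) → ℚ
invPow zero      m = 0ℚ
invPow (suc q')  m = + 1 ℚ./ (suc q' ℕ.^ m)
  where instance _ = m^n≢0 (suc q') m

ℕtoℚ : ℕ → ℚ
ℕtoℚ c = + c ℚ./ 1

indicator : ∀ {a} {A : Set a} → Dec A → ℚ
indicator (yes _) = 1ℚ
indicator (no _)  = 0ℚ

Series : Set
Series = ℕ → ℚ

_*ₛ_ : Series → Series → Series
(a *ₛ b) k = sumℚ (map (λ i → a i ℚ.* b (k ∸ i)) (upTo (suc k)))

oneMinusTdOverQn : (q n d : ℕ) → Series
oneMinusTdOverQn q n d k =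
  indicator (k ≟ 0) ℚ.- (invPow q n ℚ.* indicator (k ≟ d))

module _ {c ℓ : Level} (𝓡 : CommutativeRing c ℓ) where
  open CommutativeRing 𝓡

  pow : Carrier → ℕ → Carrier
  pow x zero    = 1#
  pow x (suc m) = x * pow x m

  ℕ·1 : ℕ → Carrier
  ℕ·1 zero    = 0#
  ℕ·1 (suc m) = 1# + ℕ·1 m

  Divides : Carrier → Carrier → Set (c ⊔ ℓ)
  Divides a x = ∃ λ y → x ≈ a * y

  IsUnit : Carrier → Set (c ⊔ ℓ)
  IsUnit u = ∃ λ w → u * w ≈ 1#

  Cong : Carrier → ℕ → Carrier → Carrier → Set (c ⊔ ℓ)
  Cong π k x y = Divides (pow π k) (x - y)

  -- R is the valuation ring of a p-adic field (a finite extension of Q_p),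
  -- i.e. a complete discrete valuation ring of characteristic 0 with
  -- uniformizer π and finite residue field of order q.
  -- (Decidability of divisibility by π^k is included as constructive data.)
  record IsPAdicValuationRing (π : Carrier) (q : ℕ) : Set (c ⊔ ℓ) where
    field
      0≉1        : ¬ (0# ≈ 1#)
      noZeroDiv  : ∀ x y → x * y ≈ 0# → (x ≈ 0#) ⊎ (y ≈ 0#)
      π≉0        : ¬ (π ≈ 0#)
      π-nonunit  : ¬ IsUnit π
      dvr        : ∀ x → ¬ (x ≈ 0#) → ∃ λ v → ∃ λ u → IsUnit u × (x ≈ pow π v * u)
      complete   : (x : ℕ → Carrier) → (∀ k → Cong π k (x (suc k)) (x k)) →
                   ∃ λ y → ∀ k → Cong π k y (x k)
      char0      : ∀ m → ¬ (ℕ·1 (suc m) ≈ 0#)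
      reps       : Vec Carrier q
      reps-cover : ∀ x → ∃ λ (i : Fin q) → Cong π 1 x (lookup reps i)
      reps-inj   : ∀ i j → Cong π 1 (lookup reps i) (lookup reps j) → i ≡ j
      divisible? : ∀ k x → Dec (Divides (pow π k) x)

  Poly : ℕ → Set c
  Poly n = List (Carrier × Vec ℕ n)

  evalMon : ∀ {n} → Vec Carrier n → Carrier × Vec ℕ n → Carrier
  evalMon xs (a , es) = a * Vec.foldr _ _*_ 1# (Vec.zipWith pow xs es)

  eval : ∀ {n} → Poly n → Vec Carrier n → Carrier
  eval f xs = foldr (λ m acc → evalMon xs m + acc) 0# f

  IsHomogeneous : ∀ {n} → ℕ → Poly n → Set (c ⊔ ℓ)
  IsHomogeneous d f = LAll.All (λ { (a , es) → (a ≈ 0#) ⊎ (Vec.sum es ≡ d) }) f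

  -- Elements of 𝒢 are represented by their coefficient families:
  -- F k A = coefficient of γ^A in φ_k(F) (A ∈ R, read modulo π^k).

  Coeffs : Set c
  Coeffs = ℕ → Carrier → ℚ

  module PAdic {π : Carrier} {q : ℕ} (P : IsPAdicValuationRing π q) where
    open IsPAdicValuationRing P

    cong? : ∀ k x y → Dec (Cong π k x y)
    cong? k x y = divisible? k (x - y)

    -- a complete system of representatives of R_k = R / π^k R
    residues : ℕ → List Carrier
    residues zero    = 0# ∷ []
    residues (suc k) = concatMap (λ a → map (λ b → a + π * b) (residues k)) (toList reps)

    tuples : (n k : ℕ) → List (Vec Carrier n)
    tuples zero    k = [] ∷ []
    tuples (suc n) k = concatMap (λ a → map (a ∷_) (tuples n k)) (residues k)

    nonzeroModπ? : ∀ {n} (A : Vec Carrier n) → Dec (¬ VAll.All (Divides (pow π 1)) A)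
    nonzeroModπ? A = ¬? (VAll.all? (divisible? 1) A)

    -- p-adic generating function G of f:
    -- φ_k(G) = q^{-nk} Σ_{A ∈ R_k^n} γ^{f(A)}
    genFun : ∀ {n} → Poly n → Coeffs
    genFun {n} f k B =
      invPow q (n ℕ.* k) ℚ.*
      ℕtoℚ (length (filter (λ A → cong? k (eval f A) B) (tuples n k)))

    -- head H of G: for k ≥ 1,
    -- φ_k(H) = q^{-nk} Σ_{A ∈ R_k^n, A ≢ 0 mod π} γ^{f(A)};
    -- φ_0(H) is the image of φ_1(H) under A_1 → A_0.
    -- (headPos f k = coefficients of φ_{k+1}(H))
    headPos : ∀ {n} → Poly n → ℕ → Carrier → ℚ
    headPos {n} f k B =
      invPow q (n ℕ.* suc k) ℚ.*
      ℕtoℚ (length (filter (λ A → nonzeroModπ? A ×-dec cong? (suc k) (eval f A) B)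
                            (tuples n (suc k))))

    headFun : ∀ {n} → Poly n → Coeffs
    headFun f zero    B = sumℚ (map (headPos f 0) (residues 1))
    headFun f (suc k) B = headPos f k B

    -- F(1) = Σ_{A ∈ R_0} F_A
    at1 : Coeffs → ℚ
    at1 F = sumℚ (map (F 0) (residues 0))

    -- F(z^s) for s = π^d (so v_π(s) = d)
    atPow : Coeffs → ℕ → Coeffs
    atPow F d k B with k ℕ.≤? d
    ... | yes _ = at1 F ℚ.* indicator (cong? k B 0#)
    ... | no  _ = sumℚ (map (λ A → F (k ∸ d) A ℚ.* indicator (cong? k (pow π d * A) B))
                            (residues (k ∸ d)))

    -- Ig(F) = Σ_k (F_{π^k R} - F_{π^{k+1} R}) t^k
    Ig : Coeffs → Series
    Ig F k = F k 0# ℚ.- F (suc k) 0#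

-- Every coefficient is a normalised count of vectors A ∈ R_k^n with
-- f(A) ≡ B (mod π^k).  For k ≥ 1 split these vectors by whether A ≡ 0 (mod π).
-- The vectors A ≢ 0 are counted by the head.  The vectors A ≡ 0 are
-- A = π(c₀ + Y) with Y ∈ R_{k-1}^n, and f(A) = π^d f(c₀ + Y) by homogeneity;
-- counting them reduces, by a periodicity argument (a function of Y that only
-- depends on Y mod π^j has a sum over R_{k-1}^n, or any translate of it,
-- that is q^{n(k-1-j)} times its sum over R_j^n), to q^{-n} times the
-- coefficient of G(z^{π^d}).  The case k = 0 is the identity
-- 1 = q^{-n}(q^n - 1) + q^{-n}.  Applying Ig coefficientwise to the first
-- identity gives the second, since Ig(G(z^{π^d})) = t^d Ig(G).
module Submission where

open import Defs
open import Level using (Level)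
open import Algebra.Bundles using (CommutativeRing)
open import Data.Nat using (ℕ; zero; suc)
open import Data.Rational as ℚ using (ℚ)
open import Data.Product using (_×_; _,_; proj₁)
open import Relation.Binary.PropositionalEquality using (_≡_)
open import Data.Empty using (⊥-elim)
open import Data.Fin.Properties using (¬Fin0)

module FiniteSums where

  open import Data.Nat as ℕ using (ℕ; zero; suc)
  import Data.Nat.Properties as ℕP
  open import Data.Fin as Fin using (Fin)
  import Data.Fin.Properties as FinP
  open import Data.Vec using (Vec; []; _∷_; lookup; toList)
  open import Data.List using (List; []; _∷_; map; concatMap; filter; length; _++_)
  open import Relation.Nullary using (¬_; Dec; yes; no)
  open import Relation.Nullary.Decidable using (¬?; _×-dec_)
  open import Relation.Binary.PropositionalEquality
  open import Data.Empty using (⊥-elim)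
  import Algebra.Properties.CommutativeSemigroup as CommSemigroupProperties

  open CommSemigroupProperties ℕP.+-commutativeSemigroup using (interchange)

  𝟙 : ∀ {a} {A : Set a} → Dec A → ℕ
  𝟙 (yes _) = 1
  𝟙 (no _)  = 0

  𝟙-cong : ∀ {a b} {A : Set a} {B : Set b} → (A → B) → (B → A) → (x : Dec A) (y : Dec B) → 𝟙 x ≡ 𝟙 y
  𝟙-cong f g (yes _) (yes _) = refl
  𝟙-cong f g (yes a) (no ¬b) = ⊥-elim (¬b (f a))
  𝟙-cong f g (no ¬a) (yes b) = ⊥-elim (¬a (g b))
  𝟙-cong f g (no _)  (no _)  = refl

  𝟙-× : ∀ {a b} {A : Set a} {B : Set b} (x : Dec A) (y : Dec B) → 𝟙 (x ×-dec y) ≡ 𝟙 x ℕ.* 𝟙 y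
  𝟙-× (yes _) (yes _) = refl
  𝟙-× (yes _) (no _)  = refl
  𝟙-× (no _)  (yes _) = refl
  𝟙-× (no _)  (no _)  = refl

  𝟙-¬ : ∀ {a} {A : Set a} (x : Dec A) → 𝟙 (¬? x) ℕ.+ 𝟙 x ≡ 1
  𝟙-¬ (yes _) = refl
  𝟙-¬ (no _)  = refl

  𝟙-yes : ∀ {a} {A : Set a} (x : Dec A) → A → 𝟙 x ≡ 1
  𝟙-yes (yes _) _ = refl
  𝟙-yes (no ¬a) a = ⊥-elim (¬a a)

  𝟙-no : ∀ {a} {A : Set a} (x : Dec A) → ¬ A → 𝟙 x ≡ 0
  𝟙-no (yes a) ¬a = ⊥-elim (¬a a)
  𝟙-no (no _)  _  = refl

  ∑ : ∀ {a} {A : Set a} → List A → (A → ℕ) → ℕ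
  ∑ []       f = 0
  ∑ (x ∷ xs) f = f x ℕ.+ ∑ xs f

  ∑-cong : ∀ {a} {A : Set a} (L : List A) {f g : A → ℕ} → (∀ x → f x ≡ g x) → ∑ L f ≡ ∑ L g
  ∑-cong []      eq = refl
  ∑-cong (x ∷ L) eq = cong₂ ℕ._+_ (eq x) (∑-cong L eq)

  ∑-++ : ∀ {a} {A : Set a} (L M : List A) (f : A → ℕ) → ∑ (L ++ M) f ≡ ∑ L f ℕ.+ ∑ M f
  ∑-++ []      M f = refl
  ∑-++ (x ∷ L) M f = trans (cong (f x ℕ.+_) (∑-++ L M f)) (sym (ℕP.+-assoc (f x) (∑ L f) (∑ M f)))

  ∑-map : ∀ {a b} {A : Set a} {B : Set b} (h : A → B) (L : List A) (f : B → ℕ) →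
    ∑ (map h L) f ≡ ∑ L (λ x → f (h x))
  ∑-map h []      f = refl
  ∑-map h (x ∷ L) f = cong (f (h x) ℕ.+_) (∑-map h L f)

  ∑-concatMap : ∀ {a b} {A : Set a} {B : Set b} (g : A → List B) (L : List A) (f : B → ℕ) →
    ∑ (concatMap g L) f ≡ ∑ L (λ x → ∑ (g x) f)
  ∑-concatMap g []      f = refl
  ∑-concatMap g (x ∷ L) f = trans (∑-++ (g x) (concatMap g L) f) (cong (∑ (g x) f ℕ.+_) (∑-concatMap g L f))

  ∑-+ : ∀ {a} {A : Set a} (L : List A) (f g : A → ℕ) → ∑ L (λ x → f x ℕ.+ g x) ≡ ∑ L f ℕ.+ ∑ L g
  ∑-+ []      f g = refl
  ∑-+ (x ∷ L) f g = trans (cong (f x ℕ.+ g x ℕ.+_) (∑-+ L f g)) (interchange (f x) (g x) (∑ L f) (∑ L g))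

  ∑-*ˡ : ∀ {a} {A : Set a} (L : List A) (c : ℕ) (f : A → ℕ) → ∑ L (λ x → c ℕ.* f x) ≡ c ℕ.* ∑ L f
  ∑-*ˡ []      c f = sym (ℕP.*-zeroʳ c)
  ∑-*ˡ (x ∷ L) c f = trans (cong (c ℕ.* f x ℕ.+_) (∑-*ˡ L c f)) (sym (ℕP.*-distribˡ-+ c (f x) (∑ L f)))

  ∑-*ʳ : ∀ {a} {A : Set a} (L : List A) (c : ℕ) (f : A → ℕ) → ∑ L (λ x → f x ℕ.* c) ≡ ∑ L f ℕ.* c
  ∑-*ʳ L c f = trans (∑-cong L (λ x → ℕP.*-comm (f x) c)) (trans (∑-*ˡ L c f) (ℕP.*-comm c (∑ L f)))

  ∑-zero : ∀ {a} {A : Set a} (L : List A) → ∑ L (λ _ → 0) ≡ 0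
  ∑-zero []      = refl
  ∑-zero (x ∷ L) = ∑-zero L

  ∑-const : ∀ {a} {A : Set a} (L : List A) (c : ℕ) → ∑ L (λ _ → c) ≡ c ℕ.* length L
  ∑-const []      c = sym (ℕP.*-zeroʳ c)
  ∑-const (x ∷ L) c = trans (cong (c ℕ.+_) (∑-const L c)) (sym (ℕP.*-suc c (length L)))

  ∑-swap : ∀ {a b} {A : Set a} {B : Set b} (L : List A) (M : List B) (f : A → B → ℕ) →
    ∑ L (λ x → ∑ M (λ y → f x y)) ≡ ∑ M (λ y → ∑ L (λ x → f x y))
  ∑-swap []      M f = sym (∑-zero M)
  ∑-swap (x ∷ L) M f =
    trans (cong (∑ M (f x) ℕ.+_) (∑-swap L M f)) (sym (∑-+ M (f x) (λ y → ∑ L (λ x' → f x' y))))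

  length-filter : ∀ {a p} {A : Set a} {P : A → Set p} (P? : ∀ x → Dec (P x)) (L : List A) →
    length (filter P? L) ≡ ∑ L (λ x → 𝟙 (P? x))
  length-filter P? [] = refl
  length-filter P? (x ∷ L) with P? x
  ... | yes _ = cong suc (length-filter P? L)
  ... | no _  = length-filter P? L

  ∑-unique : ∀ {a p} {A : Set a} {P : A → Set p} (P? : ∀ x → Dec (P x)) {m} (v : Vec A m) (i₀ : Fin m) (X : A → ℕ) →
    P (lookup v i₀) → (∀ i → P (lookup v i) → i ≡ i₀) → ∑ (toList v) (λ a → 𝟙 (P? a) ℕ.* X a) ≡ X (lookup v i₀)
  ∑-unique {P = P} P? (a ∷ v) Fin.zero X p unique =
    trans (cong₂ ℕ._+_ (cong (ℕ._* X a) (𝟙-yes (P? a) p)) (none v (λ i pi → FinP.0≢1+n (sym (unique (Fin.suc i) pi)))))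
          (trans (ℕP.+-identityʳ (1 ℕ.* X a)) (ℕP.*-identityˡ (X a)))
    where
    none : ∀ {m} (v : Vec _ m) → (∀ i → ¬ P (lookup v i)) → ∑ (toList v) (λ a → 𝟙 (P? a) ℕ.* X a) ≡ 0
    none []      h = refl
    none (a ∷ v) h = cong₂ ℕ._+_ (cong (ℕ._* X a) (𝟙-no (P? a) (h Fin.zero))) (none v (λ i → h (Fin.suc i)))
  ∑-unique P? (a ∷ v) (Fin.suc i₀) X p unique =
    trans (cong (λ t → t ℕ.* X a ℕ.+ ∑ (toList v) (λ a → 𝟙 (P? a) ℕ.* X a)) (𝟙-no (P? a) (λ pa → FinP.0≢1+n (unique Fin.zero pa))))
          (∑-unique P? v i₀ X p (λ i pi → FinP.suc-injective (unique (Fin.suc i) pi)))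

  -- vectors n L: all vectors of length n with entries from L (the same
  -- enumeration as Defs' tuples, for an arbitrary list).
  vectors : ∀ {a} {A : Set a} (n : ℕ) → List A → List (Vec A n)
  vectors zero    L = [] ∷ []
  vectors (suc n) L = concatMap (λ a → map (a ∷_) (vectors n L)) L

  ∑-vectors-suc : ∀ {a} {A : Set a} (n : ℕ) (L : List A) (h : Vec A (suc n) → ℕ) →
    ∑ (vectors (suc n) L) h ≡ ∑ L (λ a → ∑ (vectors n L) (λ B → h (a ∷ B)))
  ∑-vectors-suc n L h = trans (∑-concatMap _ L h) (∑-cong L (λ a → ∑-map (a ∷_) (vectors n L) h))

  ∏₂ : ∀ {a b} {A : Set a} {B : Set b} {n} → (B → A → ℕ) → Vec B n → Vec A n → ℕ
  ∏₂ g []      []      = 1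
  ∏₂ g (z ∷ Z) (y ∷ Y) = g z y ℕ.* ∏₂ g Z Y

  ∏ : ∀ {b} {B : Set b} {n} → (B → ℕ) → Vec B n → ℕ
  ∏ f []      = 1
  ∏ f (z ∷ Z) = f z ℕ.* ∏ f Z

  ∏-const : ∀ {b} {B : Set b} {n} (f : B → ℕ) (c : ℕ) → (∀ z → f z ≡ c) → (Z : Vec B n) → ∏ f Z ≡ c ℕ.^ n
  ∏-const f c eq []      = refl
  ∏-const f c eq (z ∷ Z) = cong₂ ℕ._*_ (eq z) (∏-const f c eq Z)

  ∑-vectors-∏ : ∀ {a b} {A : Set a} {B : Set b} (n : ℕ) (L : List A) (g : B → A → ℕ) (Z : Vec B n) →
    ∑ (vectors n L) (∏₂ g Z) ≡ ∏ (λ z → ∑ L (g z)) Z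
  ∑-vectors-∏ zero    L g []      = refl
  ∑-vectors-∏ (suc n) L g (z ∷ Z) = begin
      ∑ (vectors (suc n) L) (∏₂ g (z ∷ Z))
    ≡⟨ ∑-vectors-suc n L _ ⟩
      ∑ L (λ a → ∑ (vectors n L) (λ B → g z a ℕ.* ∏₂ g Z B))
    ≡⟨ ∑-cong L (λ a → ∑-*ˡ (vectors n L) (g z a) (∏₂ g Z)) ⟩
      ∑ L (λ a → g z a ℕ.* ∑ (vectors n L) (∏₂ g Z))
    ≡⟨ ∑-*ʳ L _ (g z) ⟩
      ∑ L (g z) ℕ.* ∑ (vectors n L) (∏₂ g Z)
    ≡⟨ cong (∑ L (g z) ℕ.*_) (∑-vectors-∏ n L g Z) ⟩
      ∑ L (g z) ℕ.* ∏ (λ z → ∑ L (g z)) Z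
    ∎ where open ≡-Reasoning

  count-vectors : ∀ {a} {A : Set a} (n : ℕ) (L : List A) → ∑ (vectors n L) (λ _ → 1) ≡ length L ℕ.^ n
  count-vectors zero    L = refl
  count-vectors (suc n) L = begin
      ∑ (vectors (suc n) L) (λ _ → 1)
    ≡⟨ ∑-vectors-suc n L _ ⟩
      ∑ L (λ a → ∑ (vectors n L) (λ _ → 1))
    ≡⟨ ∑-cong L (λ a → count-vectors n L) ⟩
      ∑ L (λ a → length L ℕ.^ n)
    ≡⟨ ∑-const L _ ⟩
      length L ℕ.^ n ℕ.* length L
    ≡⟨ ℕP.*-comm (length L ℕ.^ n) (length L) ⟩
      length L ℕ.^ suc n
    ∎ where open ≡-Reasoning

module RationalFacts where

  open import Data.Nat as ℕ using (ℕ; zero; suc; _∸_; _≤?_; _≟_)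
  import Data.Nat.Properties as ℕP
  open import Data.Integer as ℤ using (+_)
  import Data.Integer.Properties as ℤP
  open import Data.Rational as ℚ using (ℚ; 0ℚ; 1ℚ)
  import Data.Rational.Properties as ℚP
  open import Data.Rational.Unnormalised as ℚᵘ using (mkℚᵘ; *≡*)
  import Data.Rational.Unnormalised.Properties as ℚᵘP
  open import Data.List using (List; []; _∷_; map; applyUpTo)
  open import Relation.Nullary using (Dec; yes; no)
  open import Relation.Binary.PropositionalEquality
  open import Data.Empty using (⊥-elim)
  open import Data.Rational.Solver using (module +-*-Solver)
  open +-*-Solver using (solve; _:+_; _:*_; _:-_; _:=_; con)
  open FiniteSums using (𝟙; ∑)

  ℕtoℚ-suc : ∀ a → ℕtoℚ (suc a) ≡ 1ℚ ℚ.+ ℕtoℚ a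
  ℕtoℚ-suc a = ℚP.toℚᵘ-injective (ℚᵘP.≃-trans (ℚP.toℚᵘ-fromℚᵘ (mkℚᵘ (+ suc a) 0))
     (ℚᵘP.≃-trans unnormalised (ℚᵘP.≃-sym (ℚᵘP.≃-trans (ℚP.toℚᵘ-homo-+ 1ℚ (ℕtoℚ a))
       (ℚᵘP.+-cong ℚᵘP.≃-refl (ℚP.toℚᵘ-fromℚᵘ (mkℚᵘ (+ a) 0)))))))
    where
    unnormalised : mkℚᵘ (+ suc a) 0 ℚᵘ.≃ (ℚᵘ.1ℚᵘ ℚᵘ.+ mkℚᵘ (+ a) 0)
    unnormalised = *≡* (trans (ℤP.*-identityʳ (+ suc a))
      (sym (trans (ℤP.*-identityʳ _) (cong (λ t → (+ 1) ℤ.+ t) (ℤP.*-identityʳ (+ a))))))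

  ℕtoℚ-+ : ∀ a b → ℕtoℚ (a ℕ.+ b) ≡ ℕtoℚ a ℚ.+ ℕtoℚ b
  ℕtoℚ-+ zero    b = sym (ℚP.+-identityˡ (ℕtoℚ b))
  ℕtoℚ-+ (suc a) b = begin
      ℕtoℚ (suc a ℕ.+ b)                 ≡⟨ ℕtoℚ-suc (a ℕ.+ b) ⟩
      1ℚ ℚ.+ ℕtoℚ (a ℕ.+ b)              ≡⟨ cong (1ℚ ℚ.+_) (ℕtoℚ-+ a b) ⟩
      1ℚ ℚ.+ (ℕtoℚ a ℚ.+ ℕtoℚ b)         ≡⟨ ℚP.+-assoc 1ℚ (ℕtoℚ a) (ℕtoℚ b) ⟨
      (1ℚ ℚ.+ ℕtoℚ a) ℚ.+ ℕtoℚ b         ≡⟨ cong (ℚ._+ ℕtoℚ b) (ℕtoℚ-suc a) ⟨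
      ℕtoℚ (suc a) ℚ.+ ℕtoℚ b            ∎
    where open ≡-Reasoning

  ℕtoℚ-* : ∀ a b → ℕtoℚ (a ℕ.* b) ≡ ℕtoℚ a ℚ.* ℕtoℚ b
  ℕtoℚ-* zero    b = sym (ℚP.*-zeroˡ (ℕtoℚ b))
  ℕtoℚ-* (suc a) b = begin
      ℕtoℚ (b ℕ.+ a ℕ.* b)               ≡⟨ ℕtoℚ-+ b (a ℕ.* b) ⟩
      ℕtoℚ b ℚ.+ ℕtoℚ (a ℕ.* b)          ≡⟨ cong (ℕtoℚ b ℚ.+_) (ℕtoℚ-* a b) ⟩
      ℕtoℚ b ℚ.+ ℕtoℚ a ℚ.* ℕtoℚ b       ≡⟨ solve 2 (λ x y → y :+ x :* y := (con 1ℚ :+ x) :* y) refl (ℕtoℚ a) (ℕtoℚ b) ⟩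
      (1ℚ ℚ.+ ℕtoℚ a) ℚ.* ℕtoℚ b         ≡⟨ cong (ℚ._* ℕtoℚ b) (ℕtoℚ-suc a) ⟨
      ℕtoℚ (suc a) ℚ.* ℕtoℚ b            ∎
    where open ≡-Reasoning

  indicator≡𝟙 : ∀ {a} {A : Set a} (x : Dec A) → indicator x ≡ ℕtoℚ (𝟙 x)
  indicator≡𝟙 (yes _) = refl
  indicator≡𝟙 (no _)  = refl

  sumℚ-cong : ∀ {a} {A : Set a} (L : List A) {f g : A → ℚ} → (∀ x → f x ≡ g x) → sumℚ (map f L) ≡ sumℚ (map g L)
  sumℚ-cong []      eq = refl
  sumℚ-cong (x ∷ L) eq = cong₂ ℚ._+_ (eq x) (sumℚ-cong L eq)

  sumℚ-count : ∀ {a} {A : Set a} (L : List A) (c : ℚ) (w : A → ℕ) →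
    sumℚ (map (λ x → c ℚ.* ℕtoℚ (w x)) L) ≡ c ℚ.* ℕtoℚ (∑ L w)
  sumℚ-count []      c w = sym (ℚP.*-zeroʳ c)
  sumℚ-count (x ∷ L) c w = trans (cong (c ℚ.* ℕtoℚ (w x) ℚ.+_) (sumℚ-count L c w))
    (trans (sym (ℚP.*-distribˡ-+ c (ℕtoℚ (w x)) (ℕtoℚ (∑ L w)))) (cong (c ℚ.*_) (sym (ℕtoℚ-+ (w x) (∑ L w)))))

  sumℚ-linear : ∀ {a} {A : Set a} (L : List A) (u : ℚ) (f g : A → ℚ) →
    sumℚ (map (λ x → f x ℚ.- u ℚ.* g x) L) ≡ sumℚ (map f L) ℚ.- u ℚ.* sumℚ (map g L)
  sumℚ-linear []      u f g = solve 1 (λ u → con 0ℚ := con 0ℚ :- u :* con 0ℚ) refl u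
  sumℚ-linear (x ∷ L) u f g = trans (cong ((f x ℚ.- u ℚ.* g x) ℚ.+_) (sumℚ-linear L u f g))
    (solve 5 (λ u a b c e → (a :- u :* b) :+ (c :- u :* e) := (a :+ c) :- u :* (b :+ e)) refl
       u (f x) (g x) (sumℚ (map f L)) (sumℚ (map g L)))

  convolve-delta : ∀ j k (a : ℕ → ℚ) →
    sumℚ (applyUpTo (λ i → a i ℚ.* indicator (k ∸ i ≟ j)) (suc k)) ≡ a (k ∸ j) ℚ.* indicator (j ≤? k)
  convolve-delta zero    zero    a = ℚP.+-identityʳ _
  convolve-delta (suc j) zero    a = ℚP.+-identityʳ _
  convolve-delta j       (suc k) a = step (convolve-delta j k (λ i → a (suc i)))
    where
    step : ∀ {x} → x ≡ a (suc (k ∸ j)) ℚ.* indicator (j ≤? k) →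
           a 0 ℚ.* indicator (suc k ≟ j) ℚ.+ x ≡ a (suc k ∸ j) ℚ.* indicator (j ≤? suc k)
    step refl with suc k ≟ j | j ≤? k | j ≤? suc k
    ... | yes refl | yes le | _      = ⊥-elim (ℕP.<-irrefl refl le)
    ... | yes refl | no _   | yes _  =
      trans (cong (a 0 ℚ.* 1ℚ ℚ.+_) (ℚP.*-zeroʳ (a (suc (k ∸ suc k)))))
            (trans (ℚP.+-identityʳ _) (cong (λ t → a t ℚ.* 1ℚ) (sym (ℕP.n∸n≡0 (suc k)))))
    ... | yes refl | no _   | no ¬le = ⊥-elim (¬le ℕP.≤-refl)
    ... | no _     | yes le | yes _  =
      trans (cong (ℚ._+ (a (suc (k ∸ j)) ℚ.* 1ℚ)) (ℚP.*-zeroʳ (a 0)))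
            (trans (ℚP.+-identityˡ _) (cong (λ t → a t ℚ.* 1ℚ) (sym (ℕP.+-∸-assoc 1 le))))
    ... | no _     | yes le | no ¬le = ⊥-elim (¬le (ℕP.≤-trans le (ℕP.n≤1+n k)))
    ... | no j≢1+k | no ¬le | yes le = ⊥-elim (j≢1+k (sym (ℕP.≤-antisym le (ℕP.≰⇒> ¬le))))
    ... | no _     | no _   | no _   =
      trans (cong₂ ℚ._+_ (ℚP.*-zeroʳ (a 0)) (ℚP.*-zeroʳ (a (suc (k ∸ j))))) (sym (ℚP.*-zeroʳ (a (suc k ∸ j))))

  module InversePowers (q' : ℕ) where

    Q : ℕ
    Q = suc q'

    invPow-inverse : ∀ a → invPow Q a ℚ.* ℕtoℚ (Q ℕ.^ a) ≡ 1ℚ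
    invPow-inverse a = inverse (Q ℕ.^ a) {{ℕP.m^n≢0 Q a}}
      where
      inverse : ∀ N → .{{_ : ℕ.NonZero N}} → (+ 1 ℚ./ N) ℚ.* ℕtoℚ N ≡ 1ℚ
      inverse (suc N) = ℚP.toℚᵘ-injective (ℚᵘP.≃-trans (ℚP.toℚᵘ-homo-* (+ 1 ℚ./ suc N) (ℕtoℚ (suc N)))
          (ℚᵘP.≃-trans (ℚᵘP.*-cong (ℚP.toℚᵘ-fromℚᵘ (mkℚᵘ (+ 1) N)) (ℚP.toℚᵘ-fromℚᵘ (mkℚᵘ (+ suc N) 0)))
            (*≡* (trans (ℤP.*-identityʳ _) (trans (ℤP.*-identityˡ (+ suc N))
              (sym (trans (ℤP.*-identityˡ _) (ℤP.*-identityʳ _))))))))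

    inverse-unique : ∀ x y N → x ℚ.* N ≡ 1ℚ → y ℚ.* N ≡ 1ℚ → x ≡ y
    inverse-unique x y N xN≡1 yN≡1 = begin
        x                   ≡⟨ ℚP.*-identityʳ x ⟨
        x ℚ.* 1ℚ            ≡⟨ cong (x ℚ.*_) yN≡1 ⟨
        x ℚ.* (y ℚ.* N)     ≡⟨ solve 3 (λ x y N → x :* (y :* N) := y :* (x :* N)) refl x y N ⟩
        y ℚ.* (x ℚ.* N)     ≡⟨ cong (y ℚ.*_) xN≡1 ⟩
        y ℚ.* 1ℚ            ≡⟨ ℚP.*-identityʳ y ⟩
        y                   ∎
      where open ≡-Reasoning

    invPow-+ : ∀ a b → invPow Q (a ℕ.+ b) ≡ invPow Q a ℚ.* invPow Q b
    invPow-+ a b = inverse-unique _ _ (ℕtoℚ (Q ℕ.^ (a ℕ.+ b))) (invPow-inverse (a ℕ.+ b)) (begin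
        invPow Q a ℚ.* invPow Q b ℚ.* ℕtoℚ (Q ℕ.^ (a ℕ.+ b))
      ≡⟨ cong (invPow Q a ℚ.* invPow Q b ℚ.*_) (trans (cong ℕtoℚ (ℕP.^-distribˡ-+-* Q a b)) (ℕtoℚ-* (Q ℕ.^ a) (Q ℕ.^ b))) ⟩
        (invPow Q a ℚ.* invPow Q b) ℚ.* (ℕtoℚ (Q ℕ.^ a) ℚ.* ℕtoℚ (Q ℕ.^ b))
      ≡⟨ solve 4 (λ x y u v → (x :* y) :* (u :* v) := (x :* u) :* (y :* v)) refl
           (invPow Q a) (invPow Q b) (ℕtoℚ (Q ℕ.^ a)) (ℕtoℚ (Q ℕ.^ b)) ⟩
        (invPow Q a ℚ.* ℕtoℚ (Q ℕ.^ a)) ℚ.* (invPow Q b ℚ.* ℕtoℚ (Q ℕ.^ b))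
      ≡⟨ cong₂ ℚ._*_ (invPow-inverse a) (invPow-inverse b) ⟩
        1ℚ
      ∎)
      where open ≡-Reasoning

    invPow-cancel : ∀ E a T → invPow Q (E ℕ.+ a) ℚ.* ℕtoℚ (T ℕ.* Q ℕ.^ a) ≡ ℕtoℚ T ℚ.* invPow Q E
    invPow-cancel E a T = begin
        invPow Q (E ℕ.+ a) ℚ.* ℕtoℚ (T ℕ.* Q ℕ.^ a)
      ≡⟨ cong₂ ℚ._*_ (invPow-+ E a) (ℕtoℚ-* T (Q ℕ.^ a)) ⟩
        (invPow Q E ℚ.* invPow Q a) ℚ.* (ℕtoℚ T ℚ.* ℕtoℚ (Q ℕ.^ a))
      ≡⟨ solve 4 (λ x y u v → (x :* y) :* (u :* v) := u :* x :* (y :* v)) refl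
           (invPow Q E) (invPow Q a) (ℕtoℚ T) (ℕtoℚ (Q ℕ.^ a)) ⟩
        ℕtoℚ T ℚ.* invPow Q E ℚ.* (invPow Q a ℚ.* ℕtoℚ (Q ℕ.^ a))
      ≡⟨ cong (ℕtoℚ T ℚ.* invPow Q E ℚ.*_) (invPow-inverse a) ⟩
        ℕtoℚ T ℚ.* invPow Q E ℚ.* 1ℚ
      ≡⟨ ℚP.*-identityʳ _ ⟩
        ℕtoℚ T ℚ.* invPow Q E
      ∎
      where open ≡-Reasoning

module Congruences {c ℓ : Level} (𝓡 : CommutativeRing c ℓ) (π : CommutativeRing.Carrier 𝓡) where

  open import Data.Nat as ℕ using (ℕ; zero; suc)
  open import Data.Product using (_×_; _,_)
  open import Data.Sum using (_⊎_; inj₁; inj₂)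
  open import Data.Unit using (⊤; tt)
  open import Data.Vec as Vec using (Vec; []; _∷_)
  open import Data.List using ([]; _∷_)
  open import Data.List.Relation.Unary.All using ([]; _∷_)
  open import Level using (Lift; lift)
  import Relation.Binary.PropositionalEquality as ≡
  import Algebra.Properties.CommutativeSemigroup as CommSemigroupProperties
  import Algebra.Properties.AbelianGroup as AbelianGroupProperties
  import Algebra.Properties.Group as GroupProperties
  import Algebra.Properties.Ring as RingProperties
  open CommutativeRing 𝓡
  open import Relation.Binary.Reasoning.Setoid setoid
  module +-Props = CommSemigroupProperties +-commutativeSemigroup
  module *-Props = CommSemigroupProperties *-commutativeSemigroup
  open AbelianGroupProperties +-abelianGroup using (⁻¹-anti-homo‿-; ⁻¹-∙-comm)
  open GroupProperties +-group using (x∙y⁻¹≈ε⇒x≈y; x≈y⇒x∙y⁻¹≈ε)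
  open RingProperties ring using (-‿distribˡ-*; -‿distribʳ-*; x[y-z]≈xy-xz)

  _^_ : Carrier → ℕ → Carrier
  x ^ e = pow 𝓡 x e

  Div : Carrier → Carrier → Set _
  Div = Divides 𝓡

  Cg : ℕ → Carrier → Carrier → Set _
  Cg = Cong 𝓡 π

  ^-+ : ∀ x a b → x ^ (a ℕ.+ b) ≈ x ^ a * x ^ b
  ^-+ x zero    b = sym (*-identityˡ _)
  ^-+ x (suc a) b = trans (*-congˡ (^-+ x a b)) (sym (*-assoc _ _ _))

  ^-* : ∀ x y e → (x * y) ^ e ≈ x ^ e * y ^ e
  ^-* x y zero    = sym (*-identityˡ _)
  ^-* x y (suc e) = trans (*-congˡ (^-* x y e)) (*-Props.interchange x y (x ^ e) (y ^ e))

  Div-resp : ∀ {a x y} → x ≈ y → Div a x → Div a y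
  Div-resp x≈y (z , x≈az) = z , trans (sym x≈y) x≈az

  Div-0 : ∀ {a} → Div a 0#
  Div-0 {a} = 0# , sym (zeroʳ a)

  Div-+ : ∀ {a x y} → Div a x → Div a y → Div a (x + y)
  Div-+ {a} (z , e) (w , f) = z + w , trans (+-cong e f) (sym (distribˡ a z w))

  Div-neg : ∀ {a x} → Div a x → Div a (- x)
  Div-neg {a} (z , e) = - z , trans (-‿cong e) (-‿distribʳ-* a z)

  Div-*ʳ : ∀ {a x} y → Div a x → Div a (x * y)
  Div-*ʳ {a} y (z , e) = z * y , trans (*-congʳ e) (*-assoc a z y)

  Div-mono : ∀ i j {x} → Div (π ^ (i ℕ.+ j)) x → Div (π ^ i) x
  Div-mono i j (z , e) = π ^ j * z , trans e (trans (*-congʳ (^-+ π i j)) (*-assoc _ _ _))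

  sub-telescope : ∀ x y z → (x - y) + (y - z) ≈ x - z
  sub-telescope x y z = begin
      (x - y) + (y - z)      ≈⟨ +-assoc x (- y) (y - z) ⟩
      x + (- y + (y - z))    ≈⟨ +-congˡ (sym (+-assoc (- y) y (- z))) ⟩
      x + ((- y + y) - z)    ≈⟨ +-congˡ (+-congʳ (-‿inverseˡ y)) ⟩
      x + (0# - z)           ≈⟨ +-congˡ (+-identityˡ (- z)) ⟩
      x - z                  ∎

  sub-of-sums : ∀ x x' y y' → (x + x') - (y + y') ≈ (x - y) + (x' - y')
  sub-of-sums x x' y y' = begin
      (x + x') - (y + y')     ≈⟨ +-congˡ (sym (⁻¹-∙-comm y y')) ⟩
      (x + x') + (- y - y')   ≈⟨ +-Props.interchange x x' (- y) (- y') ⟩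
      (x - y) + (x' - y')     ∎

  sub-of-products : ∀ x y x' y' → (x - y) * x' + y * (x' - y') ≈ x * x' - y * y'
  sub-of-products x y x' y' = begin
      (x - y) * x' + y * (x' - y')                ≈⟨ +-cong (distribʳ x' x (- y)) (x[y-z]≈xy-xz y x' y') ⟩
      (x * x' + (- y) * x') + (y * x' - y * y')   ≈⟨ +-congʳ (+-congˡ (sym (-‿distribˡ-* y x'))) ⟩
      (x * x' - y * x') + (y * x' - y * y')       ≈⟨ sub-telescope (x * x') (y * x') (y * y') ⟩
      x * x' - y * y'                             ∎

  Cg-≈ : ∀ k {x y} → x ≈ y → Cg k x y
  Cg-≈ k x≈y = Div-resp (sym (x≈y⇒x∙y⁻¹≈ε x≈y)) Div-0

  Cg-refl : ∀ k x → Cg k x x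
  Cg-refl k x = Cg-≈ k refl

  Cg-sym : ∀ k {x y} → Cg k x y → Cg k y x
  Cg-sym k {x} {y} p = Div-resp (⁻¹-anti-homo‿- x y) (Div-neg p)

  Cg-trans : ∀ k {x y z} → Cg k x y → Cg k y z → Cg k x z
  Cg-trans k {x} {y} {z} p r = Div-resp (sub-telescope x y z) (Div-+ p r)

  Cg-+ : ∀ k {x x' y y'} → Cg k x y → Cg k x' y' → Cg k (x + x') (y + y')
  Cg-+ k {x} {x'} {y} {y'} p r = Div-resp (sym (sub-of-sums x x' y y')) (Div-+ p r)

  Cg-* : ∀ k {x x' y y'} → Cg k x y → Cg k x' y' → Cg k (x * x') (y * y')
  Cg-* k {x} {x'} {y} {y'} p r =
    Div-resp (sub-of-products x y x' y') (Div-+ (Div-*ʳ x' p) (Div-resp (*-comm _ y) (Div-*ʳ y r)))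

  Cg-resp : ∀ k {x x' y y'} → x ≈ x' → y ≈ y' → Cg k x y → Cg k x' y'
  Cg-resp k x≈x' y≈y' = Div-resp (+-cong x≈x' (-‿cong y≈y'))

  Cg-mono : ∀ i j {x y} → Cg (i ℕ.+ j) x y → Cg i x y
  Cg-mono i j = Div-mono i j

  Cg-0 : ∀ x y → Cg 0 x y
  Cg-0 x y = x - y , sym (*-identityˡ (x - y))

  Cg-scale : ∀ d m {x y} → Cg m x y → Cg (d ℕ.+ m) (π ^ d * x) (π ^ d * y)
  Cg-scale d m {x} {y} (z , e) = z , (begin
      π ^ d * x - π ^ d * y      ≈⟨ sym (x[y-z]≈xy-xz (π ^ d) x y) ⟩
      π ^ d * (x - y)            ≈⟨ *-congˡ e ⟩
      π ^ d * (π ^ m * z)        ≈⟨ sym (*-assoc _ _ _) ⟩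
      (π ^ d * π ^ m) * z        ≈⟨ *-congʳ (sym (^-+ π d m)) ⟩
      π ^ (d ℕ.+ m) * z          ∎)

  module Cancellation (π-regular : ∀ x → π * x ≈ 0# → x ≈ 0#) where

    cancel-π : ∀ k {x} → Div (π ^ suc k) (π * x) → Div (π ^ k) x
    cancel-π k {x} (z , e) = z , x∙y⁻¹≈ε⇒x≈y x (π ^ k * z) (π-regular _ (begin
        π * (x - π ^ k * z)          ≈⟨ x[y-z]≈xy-xz π x (π ^ k * z) ⟩
        π * x - π * (π ^ k * z)      ≈⟨ x≈y⇒x∙y⁻¹≈ε (trans e (*-assoc π (π ^ k) z)) ⟩
        0#                           ∎))

    Cg-cancel : ∀ d m {x y} → Cg (d ℕ.+ m) (π ^ d * x) (π ^ d * y) → Cg m x y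
    Cg-cancel zero    m p = Cg-resp m (*-identityˡ _) (*-identityˡ _) p
    Cg-cancel (suc d) m p = Cg-cancel d m (cancel-π (d ℕ.+ m) (Div-resp factor-π p))
      where
      factor-π : ∀ {x y} → (π * π ^ d) * x - (π * π ^ d) * y ≈ π * (π ^ d * x - π ^ d * y)
      factor-π = trans (+-cong (*-assoc _ _ _) (-‿cong (*-assoc _ _ _))) (sym (x[y-z]≈xy-xz π _ _))

  module EvalRespects {ℓ' : Level.Level} (_~_ : Carrier → Carrier → Set ℓ')
    (from≈ : ∀ {x y} → x ≈ y → x ~ y)
    (+-compat : ∀ {x x' y y'} → x ~ y → x' ~ y' → (x + x') ~ (y + y'))
    (*-compat : ∀ {x x' y y'} → x ~ y → x' ~ y' → (x * x') ~ (y * y')) where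

    Pointwise : ∀ {n} → Vec Carrier n → Vec Carrier n → Set ℓ'
    Pointwise []      []      = Lift ℓ' ⊤
    Pointwise (x ∷ X) (y ∷ Y) = (x ~ y) × Pointwise X Y

    ^-compat : ∀ {x y} e → x ~ y → (x ^ e) ~ (y ^ e)
    ^-compat zero    r = from≈ refl
    ^-compat (suc e) r = *-compat r (^-compat e r)

    monomial-compat : ∀ {n} (X Y : Vec Carrier n) (es : Vec ℕ n) → Pointwise X Y →
      Vec.foldr _ _*_ 1# (Vec.zipWith _^_ X es) ~ Vec.foldr _ _*_ 1# (Vec.zipWith _^_ Y es)
    monomial-compat []      []      []       r        = from≈ refl
    monomial-compat (x ∷ X) (y ∷ Y) (e ∷ es) (r , rs) = *-compat (^-compat e r) (monomial-compat X Y es rs)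

    eval-compat : ∀ {n} (f : Poly 𝓡 n) (X Y : Vec Carrier n) → Pointwise X Y → eval 𝓡 f X ~ eval 𝓡 f Y
    eval-compat []             X Y r = from≈ refl
    eval-compat ((a , es) ∷ f) X Y r = +-compat (*-compat (from≈ refl) (monomial-compat X Y es r)) (eval-compat f X Y r)

  module EvalRespects≈ = EvalRespects _≈_ (λ e → e) +-cong *-cong
  module EvalRespectsCg (k : ℕ) = EvalRespects (Cg k) (Cg-≈ k) (Cg-+ k) (Cg-* k)

  monomial-scale : ∀ {n} (W : Vec Carrier n) (es : Vec ℕ n) →
    Vec.foldr _ _*_ 1# (Vec.zipWith _^_ (Vec.map (π *_) W) es)
      ≈ π ^ Vec.sum es * Vec.foldr _ _*_ 1# (Vec.zipWith _^_ W es)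
  monomial-scale []      []       = sym (*-identityˡ _)
  monomial-scale (w ∷ W) (e ∷ es) = begin
      (π * w) ^ e * Vec.foldr _ _*_ 1# (Vec.zipWith _^_ (Vec.map (π *_) W) es)
    ≈⟨ *-cong (^-* π w e) (monomial-scale W es) ⟩
      (π ^ e * w ^ e) * (π ^ Vec.sum es * Vec.foldr _ _*_ 1# (Vec.zipWith _^_ W es))
    ≈⟨ *-Props.interchange _ _ _ _ ⟩
      (π ^ e * π ^ Vec.sum es) * (w ^ e * Vec.foldr _ _*_ 1# (Vec.zipWith _^_ W es))
    ≈⟨ *-congʳ (sym (^-+ π e (Vec.sum es))) ⟩
      π ^ (e ℕ.+ Vec.sum es) * (w ^ e * Vec.foldr _ _*_ 1# (Vec.zipWith _^_ W es))
    ∎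

  eval-homogeneous : ∀ {n} d (f : Poly 𝓡 n) → IsHomogeneous 𝓡 d f → (W : Vec Carrier n) →
    eval 𝓡 f (Vec.map (π *_) W) ≈ π ^ d * eval 𝓡 f W
  eval-homogeneous d []             []       W = sym (zeroʳ _)
  eval-homogeneous d ((a , es) ∷ f) (h ∷ hs) W =
    trans (+-cong (monomial h) (eval-homogeneous d f hs W)) (sym (distribˡ _ _ _))
    where
    monomial : (a ≈ 0#) ⊎ (Vec.sum es ≡.≡ d) →
      a * Vec.foldr _ _*_ 1# (Vec.zipWith _^_ (Vec.map (π *_) W) es)
        ≈ π ^ d * (a * Vec.foldr _ _*_ 1# (Vec.zipWith _^_ W es))
    monomial (inj₁ a≈0) = trans (trans (*-congʳ a≈0) (zeroˡ _))
                            (sym (trans (*-congˡ (trans (*-congʳ a≈0) (zeroˡ _))) (zeroʳ _)))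
    monomial (inj₂ ≡.refl) = trans (*-congˡ (monomial-scale W es)) (*-Props.x∙yz≈y∙xz _ _ _)

  -- A homogeneous polynomial of degree 0 takes congruent values modulo every
  -- π^j: both values equal its values at π^j W and π^j W', which are congruent.
  degree0-constant : ∀ {n} (f : Poly 𝓡 n) → IsHomogeneous 𝓡 0 f → (j : ℕ) (W W' : Vec Carrier n) →
    Cg j (eval 𝓡 f W) (eval 𝓡 f W')
  degree0-constant f hom j W W' =
    Cg-resp j (rescale j W) (rescale j W') (EvalRespectsCg.eval-compat j f _ _ (congruent W W'))
    where
    open EvalRespects≈ using (Pointwise; eval-compat)
    rescale : (j : ℕ) (W : Vec Carrier _) → eval 𝓡 f (Vec.map (π ^ j *_) W) ≈ eval 𝓡 f W
    rescale zero    W = eval-compat f _ _ (unit W)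
      where
      unit : ∀ {n} (W : Vec Carrier n) → Pointwise (Vec.map (1# *_) W) W
      unit []      = lift tt
      unit (w ∷ W) = *-identityˡ w , unit W
    rescale (suc j) W = begin
        eval 𝓡 f (Vec.map ((π * π ^ j) *_) W)           ≈⟨ eval-compat f _ _ (reassociate W) ⟩
        eval 𝓡 f (Vec.map (π *_) (Vec.map (π ^ j *_) W)) ≈⟨ eval-homogeneous 0 f hom (Vec.map (π ^ j *_) W) ⟩
        1# * eval 𝓡 f (Vec.map (π ^ j *_) W)           ≈⟨ *-identityˡ _ ⟩
        eval 𝓡 f (Vec.map (π ^ j *_) W)                ≈⟨ rescale j W ⟩
        eval 𝓡 f W                                     ∎
      where
      reassociate : ∀ {n} (W : Vec Carrier n) → Pointwise (Vec.map ((π * π ^ j) *_) W) (Vec.map (π *_) (Vec.map (π ^ j *_) W))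
      reassociate []      = lift tt
      reassociate (w ∷ W) = *-assoc _ _ _ , reassociate W
    congruent : ∀ {n} (W W' : Vec Carrier n) → EvalRespectsCg.Pointwise j (Vec.map (π ^ j *_) W) (Vec.map (π ^ j *_) W')
    congruent []      []        = lift tt
    congruent (w ∷ W) (w' ∷ W') = (w - w' , sym (x[y-z]≈xy-xz _ w w')) , congruent W W'

module ResidueCounting {c ℓ : Level} (𝓡 : CommutativeRing c ℓ) {π : CommutativeRing.Carrier 𝓡} {q : ℕ}
                       (P : IsPAdicValuationRing 𝓡 π q) where

  open import Data.Nat as ℕ using (zero; suc; _∸_; _≤_; s≤s)
  import Data.Nat.Properties as ℕP
  open import Data.Unit using (tt)
  open import Data.Vec as Vec using (Vec; []; _∷_; lookup; toList)
  import Data.Vec.Properties as VecP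
  import Data.Vec.Relation.Unary.All as VAll
  open import Data.List using (map; concatMap; length)
  open import Data.Product using (_,_; proj₁; proj₂)
  open import Data.Sum using (_⊎_; inj₁; inj₂)
  open import Relation.Nullary using (yes; no)
  open import Relation.Nullary.Decidable using (_×-dec_)
  import Relation.Binary.PropositionalEquality as ≡
  open ≡ using (_≡_)
  open import Data.Empty using (⊥-elim)
  open import Level using (lift)
  open import Algebra.Properties.Group using (ε⁻¹≈ε)
  open import Algebra.Properties.AbelianGroup using (xyx⁻¹≈y)
  open FiniteSums
  open CommutativeRing 𝓡
  open IsPAdicValuationRing P
  open PAdic 𝓡 P
  open Congruences 𝓡 π

  π-regular : ∀ x → π * x ≈ 0# → x ≈ 0#
  π-regular x πx≈0 with noZeroDiv π x πx≈0
  ... | inj₁ π≈0 = ⊥-elim (π≉0 π≈0)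
  ... | inj₂ x≈0 = x≈0

  open Cancellation π-regular public
  open ≡.≡-Reasoning

  ∑-residues-suc : ∀ k (g : Carrier → ℕ) →
    ∑ (residues (suc k)) g ≡ ∑ (toList reps) (λ a → ∑ (residues k) (λ b → g (a + π * b)))
  ∑-residues-suc k g = ≡.trans (∑-concatMap _ (toList reps) g) (∑-cong (toList reps) (λ a → ∑-map _ (residues k) g))

  count-residues : ∀ k → ∑ (residues k) (λ _ → 1) ≡ q ℕ.^ k
  count-residues zero    = ≡.refl
  count-residues (suc k) = begin
      ∑ (residues (suc k)) (λ _ → 1)
    ≡⟨ ∑-residues-suc k _ ⟩
      ∑ (toList reps) (λ a → ∑ (residues k) (λ _ → 1))
    ≡⟨ ∑-cong (toList reps) (λ a → count-residues k) ⟩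
      ∑ (toList reps) (λ a → q ℕ.^ k)
    ≡⟨ ∑-const (toList reps) _ ⟩
      q ℕ.^ k ℕ.* length (toList reps)
    ≡⟨ ≡.cong (q ℕ.^ k ℕ.*_) (VecP.length-toList reps) ⟩
      q ℕ.^ k ℕ.* q
    ≡⟨ ℕP.*-comm (q ℕ.^ k) q ⟩
      q ℕ.^ suc k
    ∎

  sub-0 : ∀ y → y - 0# ≈ y
  sub-0 y = trans (+-congˡ (ε⁻¹≈ε +-group)) (+-identityʳ y)

  add-sub : ∀ a y → a + (y - a) ≈ y
  add-sub a y = trans (sym (+-assoc a y (- a))) (xyx⁻¹≈y +-abelianGroup a y)

  π*≈π^1* : ∀ b → π * b ≈ π ^ 1 * b
  π*≈π^1* b = *-congʳ (sym (*-identityʳ π))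

  Cg-0-from-Div : ∀ k {y} → Div (π ^ k) y → Cg k y 0#
  Cg-0-from-Div k = Div-resp (sym (sub-0 _))

  Div-from-Cg-0 : ∀ k {y} → Cg k y 0# → Div (π ^ k) y
  Div-from-Cg-0 k = Div-resp (sub-0 _)

  Cg-1-digit : ∀ a b → Cg 1 (a + π * b) a
  Cg-1-digit a b = Cg-resp 1 refl (+-identityʳ a)
    (Cg-+ 1 (Cg-refl 1 a) (Cg-0-from-Div 1 (Div-resp (sym (π*≈π^1* b)) (b , refl))))

  ∑-reps-class : ∀ x (X : Carrier → ℕ) →
    ∑ (toList reps) (λ a → 𝟙 (cong? 1 a x) ℕ.* X a) ≡ X (lookup reps (proj₁ (reps-cover x)))
  ∑-reps-class x X = ∑-unique (λ a → cong? 1 a x) reps i₀ X (Cg-sym 1 (proj₂ (reps-cover x)))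
    (λ i p → reps-inj i i₀ (Cg-trans 1 p (proj₂ (reps-cover x))))
    where i₀ = proj₁ (reps-cover x)

  count-class : ∀ k m x → m ≤ k → ∑ (residues k) (λ y → 𝟙 (cong? m y x)) ≡ q ℕ.^ (k ∸ m)
  count-class k zero x _ = ≡.trans (∑-cong (residues k) (λ y → 𝟙-yes (cong? 0 y x) (Cg-0 y x))) (count-residues k)
  count-class (suc k) (suc m) x (s≤s m≤k) =
    ≡.trans (∑-residues-suc k _) (≡.trans (∑-cong (toList reps) by-first-digit) (∑-reps-class x (λ _ → q ℕ.^ (k ∸ m))))
    where
    -- a + π b ≡ x (mod π^{m+1}) iff a ≡ x (mod π) and b ≡ (x - a)/π (mod π^m).
    by-first-digit : ∀ a → ∑ (residues k) (λ b → 𝟙 (cong? (suc m) (a + π * b) x)) ≡ 𝟙 (cong? 1 a x) ℕ.* q ℕ.^ (k ∸ m)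
    by-first-digit a with cong? 1 a x
    ... | yes a≡x = ≡.trans (∑-cong (residues k) (λ b → 𝟙-cong (to b) (from b) _ (cong? m b e)))
                      (≡.trans (count-class k m e m≤k) (≡.sym (ℕP.+-identityʳ _)))
      where
      e = proj₁ (Cg-sym 1 a≡x)
      x-a≈πe : x - a ≈ π ^ 1 * e
      x-a≈πe = proj₂ (Cg-sym 1 a≡x)
      to : ∀ b → Cg (suc m) (a + π * b) x → Cg m b e
      to b p = Cg-cancel 1 m (Cg-resp (suc m) (trans (xyx⁻¹≈y +-abelianGroup a (π * b)) (π*≈π^1* b)) x-a≈πe
                                (Cg-+ (suc m) p (Cg-refl (suc m) (- a))))
      from : ∀ b → Cg m b e → Cg (suc m) (a + π * b) x
      from b p = Cg-resp (suc m) (+-congˡ (sym (π*≈π^1* b))) (trans (+-congˡ (sym x-a≈πe)) (add-sub a x))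
                   (Cg-+ (suc m) (Cg-refl (suc m) a) (Cg-scale 1 m p))
    ... | no a≢x = ≡.trans (∑-cong (residues k) (λ b → 𝟙-no (cong? (suc m) (a + π * b) x)
                             (λ p → a≢x (Cg-trans 1 (Cg-sym 1 (Cg-1-digit a b)) (Cg-mono 1 m p)))))
                     (∑-zero (residues k))

  count-class-self : ∀ k x → ∑ (residues k) (λ y → 𝟙 (cong? k x y)) ≡ 1
  count-class-self k x =
    ≡.trans (∑-cong (residues k) (λ y → 𝟙-cong (Cg-sym k) (Cg-sym k) (cong? k x y) (cong? k y x)))
            (≡.trans (count-class k k x ℕP.≤-refl) (≡.cong (q ℕ.^_) (ℕP.n∸n≡0 k)))

  count-class-shift : ∀ k m c x → m ≤ k → ∑ (residues k) (λ y → 𝟙 (cong? m (c + y) x)) ≡ q ℕ.^ (k ∸ m)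
  count-class-shift k m c x m≤k =
    ≡.trans (∑-cong (residues k) (λ y → 𝟙-cong (to y) (from y) (cong? m (c + y) x) (cong? m y (x - c))))
            (count-class k m (x - c) m≤k)
    where
    to : ∀ y → Cg m (c + y) x → Cg m y (x - c)
    to y p = Cg-resp m (xyx⁻¹≈y +-abelianGroup c y) refl
               (Cg-+ m p (Cg-refl m (- c)))
    from : ∀ y → Cg m y (x - c) → Cg m (c + y) x
    from y p = Cg-resp m refl (add-sub c x) (Cg-+ m (Cg-refl m c) p)

  ∑-class-indicator : ∀ m z (h : Carrier → ℕ) → (∀ A A' → Cg m A A' → h A ≡ h A') →
    ∑ (residues m) (λ A → 𝟙 (cong? m z A) ℕ.* h A) ≡ h z
  ∑-class-indicator m z h h-periodic = begin
      ∑ (residues m) (λ A → 𝟙 (cong? m z A) ℕ.* h A)   ≡⟨ ∑-cong (residues m) evaluate-at-z ⟩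
      ∑ (residues m) (λ A → 𝟙 (cong? m z A) ℕ.* h z)   ≡⟨ ∑-*ʳ (residues m) (h z) _ ⟩
      ∑ (residues m) (λ A → 𝟙 (cong? m z A)) ℕ.* h z   ≡⟨ ≡.cong (ℕ._* h z) (count-class-self m z) ⟩
      1 ℕ.* h z                                       ≡⟨ ℕP.*-identityˡ (h z) ⟩
      h z                                             ∎
    where
    evaluate-at-z : ∀ A → 𝟙 (cong? m z A) ℕ.* h A ≡ 𝟙 (cong? m z A) ℕ.* h z
    evaluate-at-z A with cong? m z A
    ... | yes z≡A = ≡.cong (ℕ._+ 0) (h-periodic A z (Cg-sym m z≡A))
    ... | no _    = ≡.refl

  -- The representative a₀ = π c₀ of the zero class, and the parametrisation
  -- b ↦ a₀ + π b of the residues ≡ 0 (mod π) modulo π^{k+1} by residues k.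
  a₀ : Carrier
  a₀ = lookup reps (proj₁ (reps-cover 0#))

  c₀ : Carrier
  c₀ = proj₁ (Div-from-Cg-0 1 (Cg-sym 1 (proj₂ (reps-cover 0#))))

  a₀≈πc₀ : a₀ ≈ π * c₀
  a₀≈πc₀ = trans (proj₂ (Div-from-Cg-0 1 (Cg-sym 1 (proj₂ (reps-cover 0#))))) (sym (π*≈π^1* c₀))

  φ : Carrier → Carrier
  φ b = a₀ + π * b

  ∑-divisible : ∀ k (g : Carrier → ℕ) →
    ∑ (residues (suc k)) (λ y → 𝟙 (divisible? 1 y) ℕ.* g y) ≡ ∑ (residues k) (λ b → g (φ b))
  ∑-divisible k g = ≡.trans (∑-residues-suc k _) (≡.trans (∑-cong (toList reps) only-zero-class)
                      (∑-reps-class 0# (λ a → ∑ (residues k) (λ b → g (a + π * b)))))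
    where
    only-zero-class : ∀ a → ∑ (residues k) (λ b → 𝟙 (divisible? 1 (a + π * b)) ℕ.* g (a + π * b))
                          ≡ 𝟙 (cong? 1 a 0#) ℕ.* ∑ (residues k) (λ b → g (a + π * b))
    only-zero-class a = ≡.trans (∑-cong (residues k) (λ b → ≡.cong (ℕ._* g (a + π * b))
        (𝟙-cong (λ π∣ → Cg-trans 1 (Cg-sym 1 (Cg-1-digit a b)) (Cg-0-from-Div 1 π∣))
                (λ a≡0 → Div-from-Cg-0 1 (Cg-trans 1 (Cg-1-digit a b) a≡0))
                (divisible? 1 (a + π * b)) (cong? 1 a 0#))))
      (∑-*ˡ (residues k) (𝟙 (cong? 1 a 0#)) (λ b → g (a + π * b)))

  allDivisible : ∀ {m} → Vec Carrier m → ℕ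
  allDivisible A = 𝟙 (VAll.all? (divisible? 1) A)

  allDivisible-∷ : ∀ {m} (a : Carrier) (A : Vec Carrier m) → allDivisible (a ∷ A) ≡ 𝟙 (divisible? 1 a) ℕ.* allDivisible A
  allDivisible-∷ a A =
    ≡.trans (𝟙-cong (λ { (x VAll.∷ xs) → x , xs }) (λ { (x , xs) → x VAll.∷ xs }) _ (divisible? 1 a ×-dec VAll.all? (divisible? 1) A))
            (𝟙-× (divisible? 1 a) _)

  ∑-vectors-divisible : ∀ n k (h : Vec Carrier n → ℕ) →
    ∑ (vectors n (residues (suc k))) (λ A → allDivisible A ℕ.* h A) ≡ ∑ (vectors n (residues k)) (λ B → h (Vec.map φ B))
  ∑-vectors-divisible zero    k h = ≡.cong (ℕ._+ 0) (ℕP.+-identityʳ (h []))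
  ∑-vectors-divisible (suc n) k h = begin
      ∑ (vectors (suc n) Rₖ₊₁) (λ A → allDivisible A ℕ.* h A)
    ≡⟨ ∑-vectors-suc n Rₖ₊₁ _ ⟩
      ∑ Rₖ₊₁ (λ a → ∑ (vectors n Rₖ₊₁) (λ A → allDivisible (a ∷ A) ℕ.* h (a ∷ A)))
    ≡⟨ ∑-cong Rₖ₊₁ (λ a → ∑-cong (vectors n Rₖ₊₁) (λ A →
          ≡.trans (≡.cong (ℕ._* h (a ∷ A)) (allDivisible-∷ a A)) (ℕP.*-assoc (𝟙 (divisible? 1 a)) _ _))) ⟩
      ∑ Rₖ₊₁ (λ a → ∑ (vectors n Rₖ₊₁) (λ A → 𝟙 (divisible? 1 a) ℕ.* (allDivisible A ℕ.* h (a ∷ A))))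
    ≡⟨ ∑-cong Rₖ₊₁ (λ a → ∑-*ˡ (vectors n Rₖ₊₁) (𝟙 (divisible? 1 a)) (λ A → allDivisible A ℕ.* h (a ∷ A))) ⟩
      ∑ Rₖ₊₁ (λ a → 𝟙 (divisible? 1 a) ℕ.* ∑ (vectors n Rₖ₊₁) (λ A → allDivisible A ℕ.* h (a ∷ A)))
    ≡⟨ ∑-cong Rₖ₊₁ (λ a → ≡.cong (𝟙 (divisible? 1 a) ℕ.*_) (∑-vectors-divisible n k (λ A → h (a ∷ A)))) ⟩
      ∑ Rₖ₊₁ (λ a → 𝟙 (divisible? 1 a) ℕ.* ∑ (vectors n (residues k)) (λ B → h (a ∷ Vec.map φ B)))
    ≡⟨ ∑-divisible k _ ⟩
      ∑ (residues k) (λ b → ∑ (vectors n (residues k)) (λ B → h (φ b ∷ Vec.map φ B)))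
    ≡⟨ ≡.sym (∑-vectors-suc n (residues k) _) ⟩
      ∑ (vectors (suc n) (residues k)) (λ B → h (Vec.map φ B))
    ∎
    where Rₖ₊₁ = residues (suc k)

  tuples≡vectors : ∀ n k → tuples n k ≡ vectors n (residues k)
  tuples≡vectors zero    k = ≡.refl
  tuples≡vectors (suc n) k = ≡.cong (λ T → concatMap (λ a → map (a ∷_) T) (residues k)) (tuples≡vectors n k)

  VCg : ∀ {n} → ℕ → Vec Carrier n → Vec Carrier n → Set _
  VCg j = EvalRespectsCg.Pointwise j

  𝟙V : ∀ {n} → ℕ → Vec Carrier n → Vec Carrier n → ℕ
  𝟙V j = ∏₂ (λ x y → 𝟙 (cong? j x y))

  Periodic : ∀ {n} → ℕ → (Vec Carrier n → ℕ) → Set _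
  Periodic j F = ∀ X Y → VCg j X Y → F X ≡ F Y

  𝟙V-zero-or-congruent : ∀ {n} j (X Y : Vec Carrier n) → (𝟙V j X Y ≡ 0) ⊎ VCg j X Y
  𝟙V-zero-or-congruent j []      []      = inj₂ (lift tt)
  𝟙V-zero-or-congruent j (x ∷ X) (y ∷ Y) with cong? j x y
  ... | no _  = inj₁ ≡.refl
  ... | yes p with 𝟙V-zero-or-congruent j X Y
  ...   | inj₁ eq = inj₁ (≡.trans (ℕP.+-identityʳ _) eq)
  ...   | inj₂ v  = inj₂ (p , v)

  ∑-vector-class-indicator : ∀ n m (Z : Vec Carrier n) (F : Vec Carrier n → ℕ) → Periodic m F →
    ∑ (vectors n (residues m)) (λ X → 𝟙V m Z X ℕ.* F X) ≡ F Z
  ∑-vector-class-indicator n m Z F F-periodic = begin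
      ∑ (vectors n (residues m)) (λ X → 𝟙V m Z X ℕ.* F X)
    ≡⟨ ∑-cong (vectors n (residues m)) evaluate-at-Z ⟩
      ∑ (vectors n (residues m)) (λ X → 𝟙V m Z X ℕ.* F Z)
    ≡⟨ ∑-*ʳ (vectors n (residues m)) _ _ ⟩
      ∑ (vectors n (residues m)) (𝟙V m Z) ℕ.* F Z
    ≡⟨ ≡.cong (ℕ._* F Z) (≡.trans (∑-vectors-∏ n (residues m) _ Z) (∏-const _ 1 (count-class-self m) Z)) ⟩
      1 ℕ.^ n ℕ.* F Z
    ≡⟨ ≡.cong (ℕ._* F Z) (ℕP.^-zeroˡ n) ⟩
      1 ℕ.* F Z
    ≡⟨ ℕP.*-identityˡ _ ⟩
      F Z
    ∎
    where
    evaluate-at-Z : ∀ X → 𝟙V m Z X ℕ.* F X ≡ 𝟙V m Z X ℕ.* F Z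
    evaluate-at-Z X with 𝟙V-zero-or-congruent m Z X
    ... | inj₁ eq = ≡.trans (≡.cong (ℕ._* F X) eq) (≡.sym (≡.cong (ℕ._* F Z) eq))
    ... | inj₂ v  = ≡.cong (𝟙V m Z X ℕ.*_) (≡.sym (F-periodic Z X v))

  𝟙V-shift : ∀ {n} m (C X Y : Vec Carrier n) →
    𝟙V m (Vec.zipWith _+_ C Y) X ≡ ∏₂ (λ cx y → 𝟙 (cong? m (proj₁ cx + y) (proj₂ cx))) (Vec.zip C X) Y
  𝟙V-shift m []      []      []      = ≡.refl
  𝟙V-shift m (c ∷ C) (x ∷ X) (y ∷ Y) = ≡.cong (𝟙 (cong? m (c + y) x) ℕ.*_) (𝟙V-shift m C X Y)

  ∑-periodic-shift : ∀ n k m (C : Vec Carrier n) (F : Vec Carrier n → ℕ) → m ≤ k → Periodic m F →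
    ∑ (vectors n (residues k)) (λ Y → F (Vec.zipWith _+_ C Y)) ≡ ∑ (vectors n (residues m)) F ℕ.* (q ℕ.^ (k ∸ m)) ℕ.^ n
  ∑-periodic-shift n k m C F m≤k F-periodic = begin
      ∑ Rₖⁿ (λ Y → F (Vec.zipWith _+_ C Y))
    ≡⟨ ∑-cong Rₖⁿ (λ Y → ≡.sym (∑-vector-class-indicator n m _ F F-periodic)) ⟩
      ∑ Rₖⁿ (λ Y → ∑ Rₘⁿ (λ X → 𝟙V m (Vec.zipWith _+_ C Y) X ℕ.* F X))
    ≡⟨ ∑-swap Rₖⁿ Rₘⁿ _ ⟩
      ∑ Rₘⁿ (λ X → ∑ Rₖⁿ (λ Y → 𝟙V m (Vec.zipWith _+_ C Y) X ℕ.* F X))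
    ≡⟨ ∑-cong Rₘⁿ (λ X → ∑-*ʳ Rₖⁿ (F X) _) ⟩
      ∑ Rₘⁿ (λ X → ∑ Rₖⁿ (λ Y → 𝟙V m (Vec.zipWith _+_ C Y) X) ℕ.* F X)
    ≡⟨ ∑-cong Rₘⁿ (λ X → ≡.cong (ℕ._* F X) (fibre X)) ⟩
      ∑ Rₘⁿ (λ X → (q ℕ.^ (k ∸ m)) ℕ.^ n ℕ.* F X)
    ≡⟨ ∑-*ˡ Rₘⁿ ((q ℕ.^ (k ∸ m)) ℕ.^ n) F ⟩
      (q ℕ.^ (k ∸ m)) ℕ.^ n ℕ.* ∑ Rₘⁿ F
    ≡⟨ ℕP.*-comm ((q ℕ.^ (k ∸ m)) ℕ.^ n) (∑ Rₘⁿ F) ⟩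
      ∑ Rₘⁿ F ℕ.* (q ℕ.^ (k ∸ m)) ℕ.^ n
    ∎
    where
    Rₖⁿ = vectors n (residues k)
    Rₘⁿ = vectors n (residues m)
    fibre : ∀ X → ∑ Rₖⁿ (λ Y → 𝟙V m (Vec.zipWith _+_ C Y) X) ≡ (q ℕ.^ (k ∸ m)) ℕ.^ n
    fibre X = ≡.trans (∑-cong Rₖⁿ (𝟙V-shift m C X))
              (≡.trans (∑-vectors-∏ n (residues k) _ (Vec.zip C X))
                (∏-const _ _ (λ cx → count-class-shift k m (proj₁ cx) (proj₂ cx) m≤k) (Vec.zip C X)))

  ∑-periodic : ∀ n k m (F : Vec Carrier n → ℕ) → m ≤ k → Periodic m F →
    ∑ (vectors n (residues k)) F ≡ ∑ (vectors n (residues m)) F ℕ.* (q ℕ.^ (k ∸ m)) ℕ.^ n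
  ∑-periodic n k m F m≤k F-periodic =
    ≡.trans (∑-cong (vectors n (residues k)) (λ Y → F-periodic _ _ (Y≡0+Y m Y)))
            (∑-periodic-shift n k m (Vec.replicate n 0#) F m≤k F-periodic)
    where
    Y≡0+Y : ∀ {n} j (Y : Vec Carrier n) → VCg j Y (Vec.zipWith _+_ (Vec.replicate n 0#) Y)
    Y≡0+Y j []      = lift tt
    Y≡0+Y j (y ∷ Y) = Cg-≈ j (sym (+-identityˡ y)) , Y≡0+Y j Y

module GeneratingFunctions {c ℓ : Level} (𝓡 : CommutativeRing c ℓ) {π : CommutativeRing.Carrier 𝓡} (q' : ℕ)
                           (P : IsPAdicValuationRing 𝓡 π (suc q')) {n : ℕ} (f : Poly 𝓡 n) where

  open import Data.Nat as ℕ using (zero; _∸_; _≤_; _≤?_; _≟_; z≤n)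
  import Data.Nat.Properties as ℕP
  open import Data.Vec as Vec using (Vec; []; _∷_)
  import Data.Vec.Relation.Unary.All as VAll
  open import Data.List using (map; filter; length; upTo)
  import Data.List.Properties as ListP
  open import Data.Product using (_,_)
  open import Relation.Nullary using (¬_; Dec; yes; no)
  open import Relation.Nullary.Decidable using (_×-dec_)
  open import Relation.Binary.PropositionalEquality
  open import Data.Empty using (⊥-elim)
  open import Data.Unit using (tt)
  open import Level using (lift; _⊔_)
  open import Data.Rational as ℚ using (ℚ; 1ℚ)
  import Data.Rational.Properties as ℚP
  open import Data.Rational.Solver using (module +-*-Solver)
  open +-*-Solver using (solve; _:+_; _:*_; _:-_; _:=_; con)
  open CommutativeRing 𝓡 hiding (refl; sym; trans; zero)
  module R = CommutativeRing 𝓡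
  open IsPAdicValuationRing P
  open PAdic 𝓡 P
  open FiniteSums
  open RationalFacts
  open InversePowers q'
  open Congruences 𝓡 π
  open ResidueCounting 𝓡 P

  G H : Coeffs 𝓡
  G = genFun f
  H = headFun f

  u : ℚ
  u = invPow Q n

  count : ℕ → Carrier → ℕ
  count k B = ∑ (vectors n (residues k)) (λ A → 𝟙 (cong? k (eval 𝓡 f A) B))

  G-as-count : ∀ k B → G k B ≡ invPow Q (n ℕ.* k) ℚ.* ℕtoℚ (count k B)
  G-as-count k B = cong (λ t → invPow Q (n ℕ.* k) ℚ.* ℕtoℚ t)
    (trans (cong (λ T → length (filter (λ A → cong? k (eval 𝓡 f A) B) T)) (tuples≡vectors n k))
           (length-filter (λ A → cong? k (eval 𝓡 f A) B) (vectors n (residues k))))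

  H-as-count : ∀ k B → headPos f k B ≡ invPow Q (n ℕ.* suc k) ℚ.*
    ℕtoℚ (∑ (vectors n (residues (suc k))) (λ A → 𝟙 (nonzeroModπ? A) ℕ.* 𝟙 (cong? (suc k) (eval 𝓡 f A) B)))
  H-as-count k B = cong (λ t → invPow Q (n ℕ.* suc k) ℚ.* ℕtoℚ t)
    (trans (cong (λ T → length (filter (λ A → nonzeroModπ? A ×-dec cong? (suc k) (eval 𝓡 f A) B) T)) (tuples≡vectors n (suc k)))
      (trans (length-filter (λ A → nonzeroModπ? A ×-dec cong? (suc k) (eval 𝓡 f A) B) (vectors n (residues (suc k))))
             (∑-cong (vectors n (residues (suc k))) (λ A → 𝟙-× (nonzeroModπ? A) (cong? (suc k) (eval 𝓡 f A) B)))))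

  Q^a^n : ∀ a → (Q ℕ.^ a) ℕ.^ n ≡ Q ℕ.^ (n ℕ.* a)
  Q^a^n a = trans (ℕP.^-*-assoc Q a n) (cong (Q ℕ.^_) (ℕP.*-comm a n))

  count-Rₖⁿ : ∀ k → ∑ (vectors n (residues k)) (λ _ → 1) ≡ Q ℕ.^ (n ℕ.* k)
  count-Rₖⁿ k = begin
      ∑ (vectors n (residues k)) (λ _ → 1)   ≡⟨ count-vectors n (residues k) ⟩
      length (residues k) ℕ.^ n              ≡⟨ cong (ℕ._^ n) length-residues ⟩
      (Q ℕ.^ k) ℕ.^ n                        ≡⟨ Q^a^n k ⟩
      Q ℕ.^ (n ℕ.* k)                        ∎
    where
    open ≡-Reasoning
    length-residues : length (residues k) ≡ Q ℕ.^ k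
    length-residues = trans (sym (ℕP.*-identityˡ _)) (trans (sym (∑-const (residues k) 1)) (count-residues k))

  -- φ₀(G) = 1 (everything is congruent modulo π⁰), so G(1) = 1.
  G-at-0 : ∀ B → G 0 B ≡ 1ℚ
  G-at-0 B = trans (G-as-count 0 B) (trans (cong₂ (λ a b → invPow Q a ℚ.* ℕtoℚ b) (ℕP.*-zeroʳ n) count-0) (ℚP.*-identityˡ _))
    where
    count-0 : count 0 B ≡ 1
    count-0 = trans (∑-cong (vectors n (residues 0)) (λ A → 𝟙-yes (cong? 0 (eval 𝓡 f A) B) (Cg-0 _ B)))
                    (trans (count-Rₖⁿ 0) (cong (Q ℕ.^_) (ℕP.*-zeroʳ n)))

  atPow-below : ∀ (F : Coeffs 𝓡) d K B → K ≤ d → atPow F d K B ≡ at1 F ℚ.* indicator (cong? K B 0#)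
  atPow-below F d K B K≤d with K ℕ.≤? d
  ... | yes _   = refl
  ... | no K≰d = ⊥-elim (K≰d K≤d)

  atPow-above : ∀ (F : Coeffs 𝓡) d K B → ¬ K ≤ d →
    atPow F d K B ≡ sumℚ (map (λ A → F (K ∸ d) A ℚ.* indicator (cong? K (π ^ d * A) B)) (residues (K ∸ d)))
  atPow-above F d K B K≰d with K ℕ.≤? d
  ... | yes K≤d = ⊥-elim (K≰d K≤d)
  ... | no _    = refl

  G-atPow-below : ∀ d K B → K ≤ d → atPow G d K B ≡ indicator (cong? K B 0#)
  G-atPow-below d K B K≤d =
    trans (atPow-below G d K B K≤d) (trans (cong (ℚ._* indicator (cong? K B 0#)) (trans (ℚP.+-identityʳ _) (G-at-0 0#)))
                                            (ℚP.*-identityˡ (indicator (cong? K B 0#))))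

  d+[K∸d]≡K : ∀ d K → ¬ K ≤ d → d ℕ.+ (K ∸ d) ≡ K
  d+[K∸d]≡K d K K≰d = ℕP.m+[n∸m]≡n (ℕP.<⇒≤ (ℕP.≰⇒> K≰d))

  Cg-scale-to : ∀ d K → ¬ K ≤ d → ∀ {x y} → Cg (K ∸ d) x y → Cg K (π ^ d * x) (π ^ d * y)
  Cg-scale-to d K K≰d p = subst (λ t → Cg t _ _) (d+[K∸d]≡K d K K≰d) (Cg-scale d (K ∸ d) p)

  𝟙-Cg-resp : ∀ K {x y} B → Cg K x y → 𝟙 (cong? K x B) ≡ 𝟙 (cong? K y B)
  𝟙-Cg-resp K B x≡y = 𝟙-cong (Cg-trans K (Cg-sym K x≡y)) (Cg-trans K x≡y) _ _

  G-atPow-above : ∀ d K B → ¬ K ≤ d → atPow G d K B ≡ invPow Q (n ℕ.* (K ∸ d)) ℚ.*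
    ℕtoℚ (∑ (vectors n (residues (K ∸ d))) (λ X → 𝟙 (cong? K (π ^ d * eval 𝓡 f X) B)))
  G-atPow-above d K B K≰d = begin
      atPow G d K B
    ≡⟨ atPow-above G d K B K≰d ⟩
      sumℚ (map (λ A → G m A ℚ.* indicator (cong? K (π ^ d * A) B)) (residues m))
    ≡⟨ sumℚ-cong (residues m) as-count ⟩
      sumℚ (map (λ A → invPow Q (n ℕ.* m) ℚ.* ℕtoℚ (count m A ℕ.* h A)) (residues m))
    ≡⟨ sumℚ-count (residues m) (invPow Q (n ℕ.* m)) (λ A → count m A ℕ.* h A) ⟩
      invPow Q (n ℕ.* m) ℚ.* ℕtoℚ (∑ (residues m) (λ A → count m A ℕ.* h A))
    ≡⟨ cong (λ t → invPow Q (n ℕ.* m) ℚ.* ℕtoℚ t) collapse ⟩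
      invPow Q (n ℕ.* m) ℚ.* ℕtoℚ (∑ (vectors n (residues m)) (λ X → h (eval 𝓡 f X)))
    ∎
    where
    open ≡-Reasoning
    m = K ∸ d
    h : Carrier → ℕ
    h A = 𝟙 (cong? K (π ^ d * A) B)
    as-count : ∀ A → G m A ℚ.* indicator (cong? K (π ^ d * A) B) ≡ invPow Q (n ℕ.* m) ℚ.* ℕtoℚ (count m A ℕ.* h A)
    as-count A = begin
        G m A ℚ.* indicator (cong? K (π ^ d * A) B)
      ≡⟨ cong₂ ℚ._*_ (G-as-count m A) (indicator≡𝟙 (cong? K (π ^ d * A) B)) ⟩
        invPow Q (n ℕ.* m) ℚ.* ℕtoℚ (count m A) ℚ.* ℕtoℚ (h A)
      ≡⟨ ℚP.*-assoc (invPow Q (n ℕ.* m)) (ℕtoℚ (count m A)) (ℕtoℚ (h A)) ⟩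
        invPow Q (n ℕ.* m) ℚ.* (ℕtoℚ (count m A) ℚ.* ℕtoℚ (h A))
      ≡⟨ cong (invPow Q (n ℕ.* m) ℚ.*_) (ℕtoℚ-* (count m A) (h A)) ⟨
        invPow Q (n ℕ.* m) ℚ.* ℕtoℚ (count m A ℕ.* h A)
      ∎
    -- Σ_A #{X : f(X) ≡ A} h(A) = Σ_X h(f(X)), since h is π^m-periodic.
    collapse : ∑ (residues m) (λ A → count m A ℕ.* h A) ≡ ∑ (vectors n (residues m)) (λ X → h (eval 𝓡 f X))
    collapse = trans (∑-cong (residues m) (λ A → sym (∑-*ʳ (vectors n (residues m)) (h A) (λ X → 𝟙 (cong? m (eval 𝓡 f X) A)))))
                 (trans (∑-swap (residues m) (vectors n (residues m)) (λ A X → 𝟙 (cong? m (eval 𝓡 f X) A) ℕ.* h A))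
                   (∑-cong (vectors n (residues m))
                     (λ X → ∑-class-indicator m (eval 𝓡 f X) h (λ A A' A≡A' → 𝟙-Cg-resp K B (Cg-scale-to d K K≰d A≡A')))))

  -- The recursion G = H + q^{-n} G(z^{π^d}) at level 0: φ₀(H) counts the
  -- Q^n - 1 nonzero vectors of R_1^n.
  nonzero-count : ℕ
  nonzero-count = ∑ (vectors n (residues 1)) (λ A → 𝟙 (nonzeroModπ? A))

  H-at-0 : ∀ B → H 0 B ≡ u ℚ.* ℕtoℚ nonzero-count
  H-at-0 B = trans (sumℚ-cong (residues 1) (H-as-count 0))
    (trans (sumℚ-count (residues 1) (invPow Q (n ℕ.* 1)) _)
      (cong₂ (λ a b → invPow Q a ℚ.* ℕtoℚ b) (ℕP.*-identityʳ n) sum-over-values))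
    where
    sum-over-values : ∑ (residues 1) (λ B' → ∑ (vectors n (residues 1)) (λ A → 𝟙 (nonzeroModπ? A) ℕ.* 𝟙 (cong? 1 (eval 𝓡 f A) B')))
                      ≡ nonzero-count
    sum-over-values = trans (∑-swap (residues 1) (vectors n (residues 1)) _)
      (∑-cong (vectors n (residues 1)) (λ A → trans (∑-*ˡ (residues 1) (𝟙 (nonzeroModπ? A)) (λ B' → 𝟙 (cong? 1 (eval 𝓡 f A) B')))
        (trans (cong (𝟙 (nonzeroModπ? A) ℕ.*_) (count-class-self 1 (eval 𝓡 f A))) (ℕP.*-identityʳ _))))

  nonzero-count+1 : nonzero-count ℕ.+ 1 ≡ Q ℕ.^ n
  nonzero-count+1 = begin
      nonzero-count ℕ.+ 1
    ≡⟨ cong (nonzero-count ℕ.+_) (sym zero-count) ⟩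
      nonzero-count ℕ.+ ∑ (vectors n (residues 1)) allDivisible
    ≡⟨ sym (∑-+ (vectors n (residues 1)) _ _) ⟩
      ∑ (vectors n (residues 1)) (λ A → 𝟙 (nonzeroModπ? A) ℕ.+ allDivisible A)
    ≡⟨ ∑-cong (vectors n (residues 1)) (λ A → 𝟙-¬ (VAll.all? (divisible? 1) A)) ⟩
      ∑ (vectors n (residues 1)) (λ _ → 1)
    ≡⟨ count-Rₖⁿ 1 ⟩
      Q ℕ.^ (n ℕ.* 1)
    ≡⟨ cong (Q ℕ.^_) (ℕP.*-identityʳ n) ⟩
      Q ℕ.^ n
    ∎
    where
    open ≡-Reasoning
    zero-count : ∑ (vectors n (residues 1)) allDivisible ≡ 1
    zero-count = trans (∑-cong (vectors n (residues 1)) (λ A → sym (ℕP.*-identityʳ (allDivisible A))))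
      (trans (∑-vectors-divisible n 0 (λ _ → 1)) (trans (count-Rₖⁿ 0) (cong (Q ℕ.^_) (ℕP.*-zeroʳ n))))

  recursion-at-0 : ∀ d B → G 0 B ≡ H 0 B ℚ.+ u ℚ.* atPow G d 0 B
  recursion-at-0 d B = sym (begin
      H 0 B ℚ.+ u ℚ.* atPow G d 0 B
    ≡⟨ cong₂ (λ a b → a ℚ.+ u ℚ.* b) (H-at-0 B) (G-atPow-below d 0 B z≤n) ⟩
      u ℚ.* ℕtoℚ nonzero-count ℚ.+ u ℚ.* indicator (cong? 0 B 0#)
    ≡⟨ cong (λ t → u ℚ.* ℕtoℚ nonzero-count ℚ.+ u ℚ.* t) (trans (indicator≡𝟙 (cong? 0 B 0#)) (cong ℕtoℚ (𝟙-yes (cong? 0 B 0#) (Cg-0 B 0#)))) ⟩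
      u ℚ.* ℕtoℚ nonzero-count ℚ.+ u ℚ.* ℕtoℚ 1
    ≡⟨ sym (ℚP.*-distribˡ-+ u (ℕtoℚ nonzero-count) (ℕtoℚ 1)) ⟩
      u ℚ.* (ℕtoℚ nonzero-count ℚ.+ ℕtoℚ 1)
    ≡⟨ cong (u ℚ.*_) (trans (sym (ℕtoℚ-+ nonzero-count 1)) (cong ℕtoℚ nonzero-count+1)) ⟩
      u ℚ.* ℕtoℚ (Q ℕ.^ n)
    ≡⟨ invPow-inverse n ⟩
      1ℚ
    ≡⟨ sym (G-at-0 B) ⟩
      G 0 B
    ∎)
    where open ≡-Reasoning

  -- For k ≥ 1 the vectors A ≡ 0 (mod π) are A = φ(Y) = π(c₀ + Y), where
  -- f(A) = π^d f(c₀ + Y); their contribution is governed by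
  -- scaledHit d K B X = [π^d f(X) ≡ B (mod π^K)].
  scaledHit : ℕ → ℕ → Carrier → Vec Carrier n → ℕ
  scaledHit d K B X = 𝟙 (cong? K (π ^ d * eval 𝓡 f X) B)

  c₀s : Vec Carrier n
  c₀s = Vec.replicate n c₀

  φ≈π[c₀+Y] : ∀ {m} (Y : Vec Carrier m) →
    EvalRespects≈.Pointwise (Vec.map φ Y) (Vec.map (π *_) (Vec.zipWith _+_ (Vec.replicate m c₀) Y))
  φ≈π[c₀+Y] []      = lift tt
  φ≈π[c₀+Y] (y ∷ Y) = R.trans (+-congʳ a₀≈πc₀) (R.sym (distribˡ π c₀ y)) , φ≈π[c₀+Y] Y

  zero-count-shifted : ∀ d → IsHomogeneous 𝓡 d f → ∀ k' B →
    ∑ (vectors n (residues (suc k'))) (λ A → allDivisible A ℕ.* 𝟙 (cong? (suc k') (eval 𝓡 f A) B))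
      ≡ ∑ (vectors n (residues k')) (λ Y → scaledHit d (suc k') B (Vec.zipWith _+_ c₀s Y))
  zero-count-shifted d hom k' B =
    trans (∑-vectors-divisible n k' (λ A → 𝟙 (cong? (suc k') (eval 𝓡 f A) B)))
          (∑-cong (vectors n (residues k')) (λ Y → 𝟙-Cg-resp (suc k') B (Cg-≈ (suc k') (f[φY]≈π^d·f[c₀+Y] Y))))
    where
    f[φY]≈π^d·f[c₀+Y] : ∀ Y → eval 𝓡 f (Vec.map φ Y) ≈ π ^ d * eval 𝓡 f (Vec.zipWith _+_ c₀s Y)
    f[φY]≈π^d·f[c₀+Y] Y = R.trans (EvalRespects≈.eval-compat f (Vec.map φ Y) (Vec.map (π *_) (Vec.zipWith _+_ c₀s Y)) (φ≈π[c₀+Y] Y))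
                                  (eval-homogeneous d f hom (Vec.zipWith _+_ c₀s Y))

  -- Case K ≤ d: π^d f(X) ≡ 0 (mod π^K), so scaledHit is the constant [B ≡ 0].
  scaledHit-below : ∀ d K B X → K ≤ d → scaledHit d K B X ≡ 𝟙 (cong? K B 0#)
  scaledHit-below d K B X K≤d = 𝟙-cong (λ p → Cg-trans K (Cg-sym K p) π^d·x≡0) (λ p → Cg-trans K π^d·x≡0 (Cg-sym K p)) _ _
    where
    π^d·x≡0 : Cg K (π ^ d * eval 𝓡 f X) 0#
    π^d·x≡0 = Cg-0-from-Div K (π ^ (d ∸ K) * eval 𝓡 f X ,
      R.sym (R.trans (R.sym (*-assoc _ _ _)) (*-congʳ (R.trans (R.sym (^-+ π K (d ∸ K))) (R.reflexive (cong (π ^_) (ℕP.m+[n∸m]≡n K≤d)))))))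

  zero-part-below : ∀ d k' B → suc k' ≤ d →
    invPow Q (n ℕ.* suc k') ℚ.* ℕtoℚ (∑ (vectors n (residues k')) (λ Y → scaledHit d (suc k') B (Vec.zipWith _+_ c₀s Y)))
      ≡ u ℚ.* atPow G d (suc k') B
  zero-part-below d k' B K≤d = begin
      invPow Q (n ℕ.* K) ℚ.* ℕtoℚ (∑ (vectors n (residues k')) (λ Y → scaledHit d K B (Vec.zipWith _+_ c₀s Y)))
    ≡⟨ cong₂ (λ a b → invPow Q a ℚ.* ℕtoℚ b) (ℕP.*-suc n k') constant-sum ⟩
      invPow Q (n ℕ.+ n ℕ.* k') ℚ.* ℕtoℚ (i ℕ.* Q ℕ.^ (n ℕ.* k'))
    ≡⟨ invPow-cancel n (n ℕ.* k') i ⟩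
      ℕtoℚ i ℚ.* u
    ≡⟨ ℚP.*-comm (ℕtoℚ i) u ⟩
      u ℚ.* ℕtoℚ i
    ≡⟨ cong (u ℚ.*_) (sym (trans (G-atPow-below d K B K≤d) (indicator≡𝟙 (cong? K B 0#)))) ⟩
      u ℚ.* atPow G d K B
    ∎
    where
    open ≡-Reasoning
    K = suc k'
    i = 𝟙 (cong? K B 0#)
    constant-sum : ∑ (vectors n (residues k')) (λ Y → scaledHit d K B (Vec.zipWith _+_ c₀s Y)) ≡ i ℕ.* Q ℕ.^ (n ℕ.* k')
    constant-sum = trans (∑-cong (vectors n (residues k')) (λ Y → trans (scaledHit-below d K B (Vec.zipWith _+_ c₀s Y) K≤d) (sym (ℕP.*-identityʳ i))))
                     (trans (∑-*ˡ (vectors n (residues k')) i (λ _ → 1)) (cong (i ℕ.*_) (count-Rₖⁿ k')))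

  -- Case K > d: scaledHit d K B is periodic modulo π^j for some j with
  -- j ≤ k' and j ≤ K - d (j = K - d if d ≥ 1; j = 0 if d = 0, f being constant).
  record Period (d k' : ℕ) (B : Carrier) : Set (c ⊔ ℓ) where
    field
      j        : ℕ
      j≤k'     : j ≤ k'
      j≤K∸d    : j ≤ suc k' ∸ d
      periodic : Periodic j (scaledHit d (suc k') B)

  period : ∀ d → IsHomogeneous 𝓡 d f → ∀ k' B → ¬ suc k' ≤ d → Period d k' B
  period zero     hom k' B _   = record
    { j = 0 ; j≤k' = z≤n ; j≤K∸d = z≤n
    ; periodic = λ X Y _ → 𝟙-Cg-resp (suc k') B (Cg-* (suc k') (Cg-refl (suc k') 1#) (degree0-constant f hom (suc k') X Y)) }
  period (suc d') hom k' B K≰d = record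
    { j = k' ∸ d' ; j≤k' = ℕP.m∸n≤m k' d' ; j≤K∸d = ℕP.≤-refl
    ; periodic = λ X Y X≡Y → 𝟙-Cg-resp (suc k') B (Cg-scale-to (suc d') (suc k') K≰d (EvalRespectsCg.eval-compat (k' ∸ d') f X Y X≡Y)) }

  -- Both sides reduce to the normalised sum T of scaledHit over R_j^n.
  zero-part-above : ∀ d k' B → ¬ suc k' ≤ d → Period d k' B →
    invPow Q (n ℕ.* suc k') ℚ.* ℕtoℚ (∑ (vectors n (residues k')) (λ Y → scaledHit d (suc k') B (Vec.zipWith _+_ c₀s Y)))
      ≡ u ℚ.* atPow G d (suc k') B
  zero-part-above d k' B K≰d per = begin
      invPow Q (n ℕ.* K) ℚ.* ℕtoℚ (∑ (vectors n (residues k')) (λ Y → F (Vec.zipWith _+_ c₀s Y)))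
    ≡⟨ cong₂ (λ a b → invPow Q a ℚ.* ℕtoℚ b) (exponent-split k' j≤k')
         (trans (∑-periodic-shift n k' j c₀s F j≤k' periodic) (cong (T ℕ.*_) (Q^a^n (k' ∸ j)))) ⟩
      invPow Q (n ℕ.* suc j ℕ.+ n ℕ.* (k' ∸ j)) ℚ.* ℕtoℚ (T ℕ.* Q ℕ.^ (n ℕ.* (k' ∸ j)))
    ≡⟨ invPow-cancel (n ℕ.* suc j) (n ℕ.* (k' ∸ j)) T ⟩
      ℕtoℚ T ℚ.* invPow Q (n ℕ.* suc j)
    ≡⟨ sym (invPow-cancel (n ℕ.* suc j) (n ℕ.* (m ∸ j)) T) ⟩
      invPow Q (n ℕ.* suc j ℕ.+ n ℕ.* (m ∸ j)) ℚ.* ℕtoℚ (T ℕ.* Q ℕ.^ (n ℕ.* (m ∸ j)))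
    ≡⟨ cong₂ (λ a b → invPow Q a ℚ.* ℕtoℚ b) (sym (trans (sym (ℕP.*-suc n m)) (exponent-split m j≤K∸d)))
         (sym (trans (∑-periodic n m j F j≤K∸d periodic) (cong (T ℕ.*_) (Q^a^n (m ∸ j))))) ⟩
      invPow Q (n ℕ.+ n ℕ.* m) ℚ.* ℕtoℚ (∑ (vectors n (residues m)) F)
    ≡⟨ cong (ℚ._* ℕtoℚ (∑ (vectors n (residues m)) F)) (invPow-+ n (n ℕ.* m)) ⟩
      (u ℚ.* invPow Q (n ℕ.* m)) ℚ.* ℕtoℚ (∑ (vectors n (residues m)) F)
    ≡⟨ ℚP.*-assoc u _ _ ⟩
      u ℚ.* (invPow Q (n ℕ.* m) ℚ.* ℕtoℚ (∑ (vectors n (residues m)) F))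
    ≡⟨ cong (u ℚ.*_) (sym (G-atPow-above d K B K≰d)) ⟩
      u ℚ.* atPow G d K B
    ∎
    where
    open ≡-Reasoning
    open Period per
    K = suc k'
    m = K ∸ d
    F = scaledHit d K B
    T = ∑ (vectors n (residues j)) F
    exponent-split : ∀ a → j ≤ a → n ℕ.* suc a ≡ n ℕ.* suc j ℕ.+ n ℕ.* (a ∸ j)
    exponent-split a j≤a = trans (cong (λ t → n ℕ.* suc t) (sym (ℕP.m+[n∸m]≡n j≤a))) (ℕP.*-distribˡ-+ n (suc j) (a ∸ j))

  zero-part : ∀ d → IsHomogeneous 𝓡 d f → ∀ k' B →
    invPow Q (n ℕ.* suc k') ℚ.*
      ℕtoℚ (∑ (vectors n (residues (suc k'))) (λ A → allDivisible A ℕ.* 𝟙 (cong? (suc k') (eval 𝓡 f A) B)))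
      ≡ u ℚ.* atPow G d (suc k') B
  zero-part d hom k' B =
    trans (cong (λ t → invPow Q (n ℕ.* suc k') ℚ.* ℕtoℚ t) (zero-count-shifted d hom k' B)) (by-cases (suc k' ℕ.≤? d))
    where
    -- a helper instead of 'with', which would also rewrite the K ≤? d inside atPow
    by-cases : Dec (suc k' ≤ d) →
      invPow Q (n ℕ.* suc k') ℚ.* ℕtoℚ (∑ (vectors n (residues k')) (λ Y → scaledHit d (suc k') B (Vec.zipWith _+_ c₀s Y)))
        ≡ u ℚ.* atPow G d (suc k') B
    by-cases (yes K≤d) = zero-part-below d k' B K≤d
    by-cases (no K≰d)  = zero-part-above d k' B K≰d (period d hom k' B K≰d)

  -- First identity of the theorem, coefficientwise: for k ≥ 1 split the
  -- vectors A ∈ R_k^n into A ≢ 0 (mod π), counted by the head, and A ≡ 0.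
  recursion : ∀ d → IsHomogeneous 𝓡 d f → ∀ k B → G k B ≡ H k B ℚ.+ u ℚ.* atPow G d k B
  recursion d hom zero     B = recursion-at-0 d B
  recursion d hom (suc k') B = begin
      G K B
    ≡⟨ G-as-count K B ⟩
      invPow Q (n ℕ.* K) ℚ.* ℕtoℚ (count K B)
    ≡⟨ cong (λ t → invPow Q (n ℕ.* K) ℚ.* ℕtoℚ t) split ⟩
      invPow Q (n ℕ.* K) ℚ.* ℕtoℚ (nonzeroCount ℕ.+ zeroCount)
    ≡⟨ cong (invPow Q (n ℕ.* K) ℚ.*_) (ℕtoℚ-+ nonzeroCount zeroCount) ⟩
      invPow Q (n ℕ.* K) ℚ.* (ℕtoℚ nonzeroCount ℚ.+ ℕtoℚ zeroCount)
    ≡⟨ ℚP.*-distribˡ-+ (invPow Q (n ℕ.* K)) (ℕtoℚ nonzeroCount) (ℕtoℚ zeroCount) ⟩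
      invPow Q (n ℕ.* K) ℚ.* ℕtoℚ nonzeroCount ℚ.+ invPow Q (n ℕ.* K) ℚ.* ℕtoℚ zeroCount
    ≡⟨ cong₂ ℚ._+_ (sym (H-as-count k' B)) (zero-part d hom k' B) ⟩
      H K B ℚ.+ u ℚ.* atPow G d K B
    ∎
    where
    open ≡-Reasoning
    K = suc k'
    hit : Vec Carrier n → ℕ
    hit A = 𝟙 (cong? K (eval 𝓡 f A) B)
    nonzeroCount = ∑ (vectors n (residues K)) (λ A → 𝟙 (nonzeroModπ? A) ℕ.* hit A)
    zeroCount = ∑ (vectors n (residues K)) (λ A → allDivisible A ℕ.* hit A)
    split : count K B ≡ nonzeroCount ℕ.+ zeroCount
    split = trans (∑-cong (vectors n (residues K)) (λ A →
                    trans (sym (ℕP.*-identityˡ (hit A)))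
                      (trans (cong (ℕ._* hit A) (sym (𝟙-¬ (VAll.all? (divisible? 1) A))))
                             (ℕP.*-distribʳ-+ (hit A) (𝟙 (nonzeroModπ? A)) (allDivisible A)))))
                  (∑-+ (vectors n (residues K)) _ _)

  G-atPow-at-0 : ∀ d j → atPow G d j 0# ≡ G (j ∸ d) 0#
  G-atPow-at-0 d j = by-cases (j ℕ.≤? d)
    where
    m = j ∸ d
    cancel-π^d : ¬ j ≤ d → ∀ X → 𝟙 (cong? j (π ^ d * eval 𝓡 f X) 0#) ≡ 𝟙 (cong? m (eval 𝓡 f X) 0#)
    cancel-π^d j≰d X = 𝟙-cong
      (λ p → Cg-cancel d m (subst (λ t → Cg t (π ^ d * eval 𝓡 f X) (π ^ d * 0#)) (sym (d+[K∸d]≡K d j j≰d))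
                              (Cg-resp j R.refl (R.sym (zeroʳ (π ^ d))) p)))
      (λ p → Cg-resp j R.refl (zeroʳ (π ^ d)) (Cg-scale-to d j j≰d p)) _ _
    by-cases : Dec (j ≤ d) → atPow G d j 0# ≡ G (j ∸ d) 0#
    by-cases (yes j≤d) = begin
        atPow G d j 0#                ≡⟨ G-atPow-below d j 0# j≤d ⟩
        indicator (cong? j 0# 0#)     ≡⟨ trans (indicator≡𝟙 (cong? j 0# 0#)) (cong ℕtoℚ (𝟙-yes (cong? j 0# 0#) (Cg-refl j 0#))) ⟩
        1ℚ                            ≡⟨ sym (G-at-0 0#) ⟩
        G 0 0#                        ≡⟨ cong (λ t → G t 0#) (sym (ℕP.m≤n⇒m∸n≡0 j≤d)) ⟩
        G (j ∸ d) 0#                  ∎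
      where open ≡-Reasoning
    by-cases (no j≰d) = trans (G-atPow-above d j 0# j≰d)
      (trans (cong (λ t → invPow Q (n ℕ.* m) ℚ.* ℕtoℚ t) (∑-cong (vectors n (residues m)) (cancel-π^d j≰d)))
             (sym (G-as-count m 0#)))

  H-as-difference : ∀ d → IsHomogeneous 𝓡 d f → ∀ k B → H k B ≡ G k B ℚ.- u ℚ.* atPow G d k B
  H-as-difference d hom k B = trans (add-sub-cancel (H k B) (u ℚ.* atPow G d k B))
                                    (cong (ℚ._- u ℚ.* atPow G d k B) (sym (recursion d hom k B)))
    where
    add-sub-cancel : ∀ h x → h ≡ (h ℚ.+ x) ℚ.- x
    add-sub-cancel = solve 2 (λ h x → h := (h :+ x) :- x) refl

  Ig-shifted : ∀ d k → Ig G (k ∸ d) ℚ.* indicator (d ℕ.≤? k) ≡ G (k ∸ d) 0# ℚ.- G (suc k ∸ d) 0#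
  Ig-shifted d k = by-cases (d ℕ.≤? k)
    where
    by-cases : (d≤?k : Dec (d ≤ k)) → Ig G (k ∸ d) ℚ.* indicator d≤?k ≡ G (k ∸ d) 0# ℚ.- G (suc k ∸ d) 0#
    by-cases (yes d≤k) = trans (ℚP.*-identityʳ (Ig G (k ∸ d))) (cong (λ t → G (k ∸ d) 0# ℚ.- G t 0#) (sym (ℕP.+-∸-assoc 1 d≤k)))
    by-cases (no d≰k)  = trans (ℚP.*-zeroʳ (Ig G (k ∸ d))) (trans (sym (ℚP.+-inverseʳ (G 0 0#)))
      (cong₂ (λ a b → G a 0# ℚ.- G b 0#) (sym (ℕP.m≤n⇒m∸n≡0 (ℕP.<⇒≤ (ℕP.≰⇒> d≰k)))) (sym (ℕP.m≤n⇒m∸n≡0 (ℕP.≰⇒> d≰k)))))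

  zeta-relation : ∀ d → IsHomogeneous 𝓡 d f → ∀ k → (Ig G *ₛ oneMinusTdOverQn Q n d) k ≡ Ig H k
  zeta-relation d hom k = begin
      (Ig G *ₛ oneMinusTdOverQn Q n d) k
    ≡⟨ sumℚ-cong (upTo (suc k)) (λ i → distribute (Ig G i) (t^0 i) u (t^d i)) ⟩
      sumℚ (map (λ i → Ig G i ℚ.* t^0 i ℚ.- u ℚ.* (Ig G i ℚ.* t^d i)) (upTo (suc k)))
    ≡⟨ sumℚ-linear (upTo (suc k)) u (λ i → Ig G i ℚ.* t^0 i) (λ i → Ig G i ℚ.* t^d i) ⟩
      sumℚ (map (λ i → Ig G i ℚ.* t^0 i) (upTo (suc k))) ℚ.- u ℚ.* sumℚ (map (λ i → Ig G i ℚ.* t^d i) (upTo (suc k)))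
    ≡⟨ cong₂ (λ a b → a ℚ.- u ℚ.* b)
         (trans (cong sumℚ (ListP.map-upTo (λ i → Ig G i ℚ.* t^0 i) (suc k))) (convolve-delta 0 k (Ig G)))
         (trans (cong sumℚ (ListP.map-upTo (λ i → Ig G i ℚ.* t^d i) (suc k))) (convolve-delta d k (Ig G))) ⟩
      Ig G k ℚ.* indicator (0 ℕ.≤? k) ℚ.- u ℚ.* (Ig G (k ∸ d) ℚ.* indicator (d ℕ.≤? k))
    ≡⟨ cong₂ (λ a b → Ig G k ℚ.* a ℚ.- u ℚ.* b) (trans (indicator≡𝟙 (0 ℕ.≤? k)) (cong ℕtoℚ (𝟙-yes (0 ℕ.≤? k) z≤n))) (Ig-shifted d k) ⟩
      Ig G k ℚ.* 1ℚ ℚ.- u ℚ.* (G (k ∸ d) 0# ℚ.- G (suc k ∸ d) 0#)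
    ≡⟨ regroup (G k 0#) (G (suc k) 0#) u (G (k ∸ d) 0#) (G (suc k ∸ d) 0#) ⟩
      (G k 0# ℚ.- u ℚ.* G (k ∸ d) 0#) ℚ.- (G (suc k) 0# ℚ.- u ℚ.* G (suc k ∸ d) 0#)
    ≡⟨ cong₂ (λ a b → (G k 0# ℚ.- u ℚ.* a) ℚ.- (G (suc k) 0# ℚ.- u ℚ.* b)) (sym (G-atPow-at-0 d k)) (sym (G-atPow-at-0 d (suc k))) ⟩
      (G k 0# ℚ.- u ℚ.* atPow G d k 0#) ℚ.- (G (suc k) 0# ℚ.- u ℚ.* atPow G d (suc k) 0#)
    ≡⟨ cong₂ ℚ._-_ (sym (H-as-difference d hom k 0#)) (sym (H-as-difference d hom (suc k) 0#)) ⟩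
      Ig H k
    ∎
    where
    open ≡-Reasoning
    t^0 t^d : ℕ → ℚ
    t^0 i = indicator (k ∸ i ℕ.≟ 0)
    t^d i = indicator (k ∸ i ℕ.≟ d)
    distribute : ∀ a x w y → a ℚ.* (x ℚ.- w ℚ.* y) ≡ a ℚ.* x ℚ.- w ℚ.* (a ℚ.* y)
    distribute = solve 4 (λ a x w y → a :* (x :- w :* y) := a :* x :- w :* (a :* y)) refl
    regroup : ∀ g₀ g₁ w s₀ s₁ → (g₀ ℚ.- g₁) ℚ.* 1ℚ ℚ.- w ℚ.* (s₀ ℚ.- s₁) ≡ (g₀ ℚ.- w ℚ.* s₀) ℚ.- (g₁ ℚ.- w ℚ.* s₁)
    regroup = solve 5 (λ g₀ g₁ w s₀ s₁ → (g₀ :- g₁) :* con 1ℚ :- w :* (s₀ :- s₁) := (g₀ :- w :* s₀) :- (g₁ :- w :* s₁)) refl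

-- A p-adic valuation ring has a nonempty residue field, so q = suc q'; the
-- two identities are then `recursion` and `zeta-relation`.
lemma3p20 : ∀ {c ℓ : Level} (𝓡 : CommutativeRing c ℓ) (π : CommutativeRing.Carrier 𝓡) (q : ℕ)
              (P : IsPAdicValuationRing 𝓡 π q) (n d : ℕ) (f : Poly 𝓡 n) →
              IsHomogeneous 𝓡 d f →
              (∀ k B → PAdic.genFun 𝓡 P f k B
                         ≡ PAdic.headFun 𝓡 P f k B
                           ℚ.+ invPow q n ℚ.* PAdic.atPow 𝓡 P (PAdic.genFun 𝓡 P f) d k B)
              × (∀ k → (PAdic.Ig 𝓡 P (PAdic.genFun 𝓡 P f) *ₛ oneMinusTdOverQn q n d) k
                         ≡ PAdic.Ig 𝓡 P (PAdic.headFun 𝓡 P f) k)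
lemma3p20 𝓡 π zero     P n d f hom = ⊥-elim (¬Fin0 (proj₁ (IsPAdicValuationRing.reps-cover P (CommutativeRing.0# 𝓡))))
lemma3p20 𝓡 π (suc q') P n d f hom = recursion d hom , zeta-relation d hom
  where open GeneratingFunctions 𝓡 q' P f
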